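{- Let $c,K>0$ be absolute constants. For a prime $a_3$, let $N'=\lceil (a_3/(cK))^2\rceil$, let $X=\lceil c\sqrt{N'}\rceil$, let $\mathbf{U}$ be the uniform distribution on $\{1,\dots,X\}$, and for $r\in\{1,\dots,a_3\}$ let $\mathbf{U}'_r=(r\cdot\mathbf{U}\bmod a_3)$. Then for every sufficiently large prime $a_3$ there is a subset $\{q_1,\dots,q_t\}\subset\{1,\dots,a_3\}$ of $t\ge a_3^{1/3}$ values such that for all $q_i\ne q_j$ in this subset, $d_{TV}(\mathbf{U}'_{q_i},\mathbf{U}'_{q_j})\ge 1-\frac{3}{K}$.
   Context: $(r\cdot\mathbf{U}\bmod a_3)$ is the distribution of $r\cdot u$ reduced modulo $a_3$ (into $\{0,\dots,a_3-1\}$) where $u\sim\mathbf{U}$. $d_{TV}$ is total variation distance.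
   Formalization: The absolute constants c and K range over the positive rationals. -}

module Defs where

open import Data.Nat as ℕ using (ℕ; zero; suc; NonZero)
open import Data.Nat.DivMod using (_%_)
open import Data.Integer as ℤ using (ℤ; +_)
open import Data.Rational as ℚ using (ℚ; 0ℚ; 1ℚ; _÷_; ceiling; >-nonZero)
open import Data.List using (List; map; filter; length; upTo; foldr)
open import Relation.Nullary.Decidable using (does)
open import Data.Product using (_×_)

toℚ : ℕ → ℚ
toℚ n = (+ n) ℚ./ 1

N′ : (c K : ℚ) → 0ℚ ℚ.< c → 0ℚ ℚ.< K → ℕ → ℕ
N′ c K c>0 K>0 a₃ =
  let y = _÷_ (_÷_ (toℚ a₃) c {{>-nonZero c>0}}) K {{>-nonZero K>0}}
  in ℤ.∣ ceiling (y ℚ.* y) ∣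

-- X = ⌈ c √N ⌉ for c > 0, N ≥ 1 : since c √N > 0, X is characterised as the
-- natural number with  (X - 1)² < c² N ≤ X²  (i.e. X - 1 < c √N ≤ X).
IsCeilCSqrt : ℚ → ℕ → ℕ → Set
IsCeilCSqrt c N X =
  (c ℚ.* c ℚ.* toℚ N ℚ.≤ toℚ X ℚ.* toℚ X) ×
  (toℚ (X ℕ.∸ 1) ℚ.* toℚ (X ℕ.∸ 1) ℚ.< c ℚ.* c ℚ.* toℚ N)

count : (m : ℕ) .{{_ : NonZero m}} → (X r v : ℕ) → ℕ
count m X r v = length (filter (λ u → ((r ℕ.* u) % m) ℕ.≟ v) (map suc (upTo X)))

probU′ : (m : ℕ) .{{_ : NonZero m}} → (X r v : ℕ) → ℚ
probU′ m zero r v = 0ℚ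
probU′ m (suc X₀) r v = (+ count m (suc X₀) r v) ℚ./ suc X₀

sumℚ : List ℚ → ℚ
sumℚ = foldr ℚ._+_ 0ℚ

dTV : (m : ℕ) .{{_ : NonZero m}} → (X r s : ℕ) → ℚ
dTV m X r s = ℚ.½ ℚ.* sumℚ (map (λ v → ℚ.∣ probU′ m X r v ℚ.- probU′ m X s v ∣) (upTo m))

bound : (K : ℚ) → 0ℚ ℚ.< K → ℚ
bound K K>0 = 1ℚ ℚ.- _÷_ (toℚ 3) K {{>-nonZero K>0}}

module Submission where

-- Let p be a large prime, X = ⌈c√N′⌉ ≈ p/K and U uniform on {1,…,X}.  For
-- multipliers r ≠ s let C(r,s) be the number of collisions: pairs (u,w) ∈ [1,X]²
-- with s·w ≡ r·u (mod p).  The proof has three mathematical steps: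
--   (1) dTV(rU mod p, sU mod p) ≥ 1 - C(r,s)/X, since x + y ≤ |x-y| + 2xy for
--       natural numbers and both count vectors sum to X;
--   (2) with g = gcd(r,s), a = r/g, b = s/g the map
--       (u,w) ↦ (⌊(u-1)/b⌋, ⌊(a·u + b·X - b·w)/p⌋) is injective on collisions,
--       whence p·b·C(r,s) ≤ (2bX + p)(X + b);
--   (3) on the block of multipliers (M, M+t] with t = ⌈p^{1/3}⌉ and M = 4κt
--       (κ ≥ K an integer) every pair has 4κ ≤ b and 8bκ ≤ p, and then (2)
--       gives C(r,s)·K ≤ 3X, i.e. dTV ≥ 1 - 3/K.
-- The file develops the rational arithmetic (casts, ceilings, the size of X),
-- finite sums and step (1), congruences and step (2), step (3), integer cube
-- roots, the choice of constants and multipliers, and finally the theorem.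

open import Defs
open import Data.Nat using (ℕ; NonZero)
open import Data.Rational using (ℚ; 0ℚ) renaming (_<_ to _<ℚ_)

-- The embedding toℚ : ℕ → ℚ is a homomorphism of ordered semirings.  Since
-- toℚ n is by definition fromℚᵘ (n / 1), everything is checked in ℚᵘ.
module Cast where

  open import Data.Nat as ℕ using (ℕ; suc)
  import Data.Nat.Properties as ℕP
  open import Data.Integer as ℤ using (+_)
  import Data.Integer.Properties as ℤP
  open import Data.Rational as ℚ using (ℚ; 0ℚ; 1ℚ; _≤_; _<_; _+_; _*_)
  import Data.Rational.Properties as ℚP
  open import Data.Rational.Unnormalised as ℚᵘ using (mkℚᵘ; _≃_; *≡*; *≤*; *<*)
  import Data.Rational.Unnormalised.Properties as ℚᵘP
  open import Relation.Binary.PropositionalEquality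
  open import Data.Integer.Solver using (module +-*-Solver)
  open +-*-Solver

  toℚᵘ-toℚ : ∀ n → ℚ.toℚᵘ (toℚ n) ≃ mkℚᵘ (+ n) 0
  toℚᵘ-toℚ n = ℚP.toℚᵘ-fromℚᵘ (mkℚᵘ (+ n) 0)

  toℚ-+ : ∀ m n → toℚ (m ℕ.+ n) ≡ toℚ m + toℚ n
  toℚ-+ m n = ℚP.toℚᵘ-injective (ℚᵘP.≃-trans (toℚᵘ-toℚ (m ℕ.+ n)) (ℚᵘP.≃-trans sum≃
    (ℚᵘP.≃-sym (ℚᵘP.≃-trans (ℚP.toℚᵘ-homo-+ (toℚ m) (toℚ n)) (ℚᵘP.+-cong (toℚᵘ-toℚ m) (toℚᵘ-toℚ n))))))
    where
    sum≃ : mkℚᵘ (+ (m ℕ.+ n)) 0 ≃ mkℚᵘ (+ m) 0 ℚᵘ.+ mkℚᵘ (+ n) 0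
    sum≃ = *≡* (trans (cong (ℤ._* + 1) (ℤP.pos-+ m n))
      (solve 2 (λ a b → (a :+ b) :* con (+ 1) := (a :* con (+ 1) :+ b :* con (+ 1)) :* con (+ 1)) refl (+ m) (+ n)))

  toℚ-* : ∀ m n → toℚ (m ℕ.* n) ≡ toℚ m * toℚ n
  toℚ-* m n = ℚP.toℚᵘ-injective (ℚᵘP.≃-trans (toℚᵘ-toℚ (m ℕ.* n)) (ℚᵘP.≃-trans prod≃
    (ℚᵘP.≃-sym (ℚᵘP.≃-trans (ℚP.toℚᵘ-homo-* (toℚ m) (toℚ n)) (ℚᵘP.*-cong (toℚᵘ-toℚ m) (toℚᵘ-toℚ n))))))
    where
    prod≃ : mkℚᵘ (+ (m ℕ.* n)) 0 ≃ mkℚᵘ (+ m) 0 ℚᵘ.* mkℚᵘ (+ n) 0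
    prod≃ = *≡* (cong (ℤ._* + 1) (ℤP.pos-* m n))

  toℚ-mono-≤ : ∀ {m n} → m ℕ.≤ n → toℚ m ≤ toℚ n
  toℚ-mono-≤ {m} {n} m≤n = ℚP.toℚᵘ-cancel-≤
    (ℚᵘP.≤-respʳ-≃ (ℚᵘP.≃-sym (toℚᵘ-toℚ n)) (ℚᵘP.≤-respˡ-≃ (ℚᵘP.≃-sym (toℚᵘ-toℚ m))
      (*≤* (ℤP.*-monoʳ-≤-nonNeg (+ 1) (ℤ.+≤+ m≤n)))))

  toℚ-mono-< : ∀ {m n} → m ℕ.< n → toℚ m < toℚ n
  toℚ-mono-< {m} {n} m<n = ℚP.toℚᵘ-cancel-<
    (ℚᵘP.<-respʳ-≃ (ℚᵘP.≃-sym (toℚᵘ-toℚ n)) (ℚᵘP.<-respˡ-≃ (ℚᵘP.≃-sym (toℚᵘ-toℚ m))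
      (*<* (ℤP.*-monoʳ-<-pos (+ 1) (ℤ.+<+ m<n)))))

  toℚ-nonNeg : ∀ n → 0ℚ ≤ toℚ n
  toℚ-nonNeg n = toℚ-mono-≤ (ℕ.z≤n {n})

  recip : ℕ → ℚ
  recip k = (+ 1) ℚ./ suc k

  recip-nonNeg : ∀ k → 0ℚ ≤ recip k
  recip-nonNeg k = ℚP.nonNegative⁻¹ (recip k) {{ℚP.normalize-nonNeg 1 (suc k)}}

  /-as-recip : ∀ n k → (+ n) ℚ./ suc k ≡ toℚ n * recip k
  /-as-recip n k = ℚP.toℚᵘ-injective (ℚᵘP.≃-trans (ℚP.toℚᵘ-fromℚᵘ (mkℚᵘ (+ n) k)) (ℚᵘP.≃-trans quot≃
    (ℚᵘP.≃-sym (ℚᵘP.≃-trans (ℚP.toℚᵘ-homo-* (toℚ n) (recip k))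
      (ℚᵘP.*-cong (toℚᵘ-toℚ n) (ℚP.toℚᵘ-fromℚᵘ (mkℚᵘ (+ 1) k)))))))
    where
    quot≃ : mkℚᵘ (+ n) k ≃ mkℚᵘ (+ n) 0 ℚᵘ.* mkℚᵘ (+ 1) k
    quot≃ = *≡* (trans (cong (λ z → + n ℤ.* + suc z) (ℕP.+-identityʳ k))
      (solve 2 (λ a b → a :* b := (a :* con (+ 1)) :* b) refl (+ n) (+ suc k)))

  recip-inverse : ∀ k → toℚ (suc k) * recip k ≡ 1ℚ
  recip-inverse k = ℚP.toℚᵘ-injective (ℚᵘP.≃-trans (ℚP.toℚᵘ-homo-* (toℚ (suc k)) (recip k))
    (ℚᵘP.≃-trans (ℚᵘP.*-cong (toℚᵘ-toℚ (suc k)) (ℚP.toℚᵘ-fromℚᵘ (mkℚᵘ (+ 1) k))) inverse≃))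
    where
    inverse≃ : mkℚᵘ (+ suc k) 0 ℚᵘ.* mkℚᵘ (+ 1) k ≃ mkℚᵘ (+ 1) 0
    inverse≃ = *≡* (trans (solve 1 (λ b → (b :* con (+ 1)) :* con (+ 1) := con (+ 1) :* b) refl (+ suc k))
      (cong (λ z → + 1 ℤ.* + suc z) (sym (ℕP.+-identityʳ k))))

module Ceiling where

  open import Data.Nat as ℕ using (ℕ; zero; suc)
  import Data.Nat.Properties as ℕP
  open import Data.Integer as ℤ using (ℤ; +_; -[1+_]; +[1+_])
  import Data.Integer.Properties as ℤP
  import Data.Integer.DivMod as ℤD
  open import Data.Rational as ℚ using (ℚ; 0ℚ; 1ℚ; mkℚ; _≤_; _<_; _+_)
  import Data.Rational.Properties as ℚP
  open import Data.Rational.Unnormalised as ℚᵘ using (mkℚᵘ; *≤*; *<*)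
  import Data.Rational.Unnormalised.Properties as ℚᵘP
  open import Data.Nat.Coprimality using (Coprime)
  open import Relation.Binary.PropositionalEquality
  open import Data.Product using (_×_; _,_; ∃)
  open import Data.Integer.Solver using (module +-*-Solver)
  open +-*-Solver
  open Cast

  between-ceiling : ∀ m d .(cop : Coprime m (suc d)) N →
    m ℕ.≤ N ℕ.* suc d → N ℕ.* suc d ℕ.< m ℕ.+ suc d →
    (mkℚ (+ m) d cop ≤ toℚ N) × (toℚ N < mkℚ (+ m) d cop + 1ℚ)
  between-ceiling m d cop N lower upper =
    ℚP.toℚᵘ-cancel-≤ (ℚᵘP.≤-respʳ-≃ (ℚᵘP.≃-sym (toℚᵘ-toℚ N))
      (*≤* (subst₂ ℤ._≤_ (sym (ℤP.*-identityʳ (+ m))) (ℤP.pos-* N (suc d)) (ℤ.+≤+ lower)))) ,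
    ℚP.toℚᵘ-cancel-< (ℚᵘP.<-respʳ-≃ (ℚᵘP.≃-sym (ℚP.toℚᵘ-homo-+ (mkℚ (+ m) d cop) 1ℚ))
      (ℚᵘP.<-respˡ-≃ (ℚᵘP.≃-sym (toℚᵘ-toℚ N)) (*<* upper′)))
    where
    upper′ : + N ℤ.* ℚᵘ.↧ (mkℚᵘ (+ m) d ℚᵘ.+ mkℚᵘ (+ 1) 0) ℤ.< ℚᵘ.↥ (mkℚᵘ (+ m) d ℚᵘ.+ mkℚᵘ (+ 1) 0) ℤ.* + 1
    upper′ = subst₂ ℤ._<_
      (trans (ℤP.pos-* N (suc d)) (cong (λ x → + N ℤ.* + suc x) (sym (ℕP.*-identityʳ d))))
      (trans (ℤP.pos-+ m (suc d))
        (solve 2 (λ a b → a :+ b := (a :* con (+ 1) :+ con (+ 1) :* b) :* con (+ 1)) refl (+ m) (+ suc d)))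
      (ℤ.+<+ upper)

  -- For n = k+1 and denominator d+1:  ⌈n/(d+1)⌉·(d+1) = n + ((-n) mod (d+1)).
  ceiling-times-denominator : ∀ k d →
    (ℤ.- (-[1+ k ] ℤ./ +[1+ d ])) ℤ.* + suc d ≡ + (-[1+ k ] ℤ.% +[1+ d ] ℕ.+ suc k)
  ceiling-times-denominator k d = begin
    (ℤ.- f) ℤ.* + suc d
      ≡⟨ solve 4 (λ f D r s → (:- f) :* D := (r :+ s) :- ((r :+ f :* D) :+ s)) refl f (+ suc d) (+ r) (+ suc k) ⟩
    (+ r ℤ.+ + suc k) ℤ.- ((+ r ℤ.+ f ℤ.* + suc d) ℤ.+ + suc k)
      ≡⟨ cong (λ x → (+ r ℤ.+ + suc k) ℤ.- (x ℤ.+ + suc k)) (sym (ℤD.a≡a%n+[a/n]*n -[1+ k ] +[1+ d ])) ⟩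
    (+ r ℤ.+ + suc k) ℤ.- (ℤ.- (+ suc k) ℤ.+ + suc k)
      ≡⟨ solve 2 (λ r s → (r :+ s) :- ((:- s) :+ s) := r :+ s) refl (+ r) (+ suc k) ⟩
    + r ℤ.+ + suc k
      ≡⟨ sym (ℤP.pos-+ r (suc k)) ⟩
    + (r ℕ.+ suc k) ∎
    where
    open ≡-Reasoning
    f = -[1+ k ] ℤ./ +[1+ d ]
    r = -[1+ k ] ℤ.% +[1+ d ]

  nonNeg-factor : ∀ (z : ℤ) (d m : ℕ) → z ℤ.* + suc d ≡ + m → ∃ λ N → (z ≡ + N) × (N ℕ.* suc d ≡ m)
  nonNeg-factor (+ N) d m eq = N , refl , ℤP.+-injective (trans (ℤP.pos-* N (suc d)) eq)
  nonNeg-factor -[1+ j ] d m ()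

  ceiling-bounds : ∀ (q : ℚ) → 0ℚ ≤ q →
    (q ≤ toℚ ℤ.∣ ℚ.ceiling q ∣) × (toℚ ℤ.∣ ℚ.ceiling q ∣ < q + 1ℚ)
  ceiling-bounds (mkℚ (+ zero) d cop) _ = between-ceiling 0 d cop 0 ℕ.z≤n (ℕ.s≤s ℕ.z≤n)
  ceiling-bounds (mkℚ +[1+ k ] d cop) _
    with nonNeg-factor (ℤ.- (-[1+ k ] ℤ./ +[1+ d ])) d _ (ceiling-times-denominator k d)
  ... | N , ceil≡N , N*den rewrite ceil≡N = between-ceiling (suc k) d cop N
        (subst (suc k ℕ.≤_) (sym N*den) (ℕP.m≤n+m (suc k) r))
        (subst (ℕ._< suc k ℕ.+ suc d) (sym N*den)
          (subst (ℕ._< suc k ℕ.+ suc d) (ℕP.+-comm (suc k) r) (ℕP.+-monoʳ-< (suc k) (ℤD.n%d<d -[1+ k ] +[1+ d ]))))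
    where r = -[1+ k ] ℤ.% +[1+ d ]
  ceiling-bounds (mkℚ -[1+ k ] d cop) (ℚ.*≤* ())

-- Monotonicity of multiplication in the ordered field ℚ, stated with explicit
-- sign hypotheses (the library versions take them as instances), and squares.
module RationalOrder where

  open import Data.Rational as ℚ using (0ℚ; _≤_; _<_; _+_; _*_)
  import Data.Rational.Properties as ℚP
  open import Relation.Binary.PropositionalEquality
  open import Relation.Nullary using (yes; no; ¬_)
  open import Relation.Nullary.Negation using (contradiction)

  mulʳ-≤ : ∀ {a b} r → 0ℚ ≤ r → a ≤ b → a * r ≤ b * r
  mulʳ-≤ r 0≤r = ℚP.*-monoʳ-≤-nonNeg r {{ℚ.nonNegative 0≤r}}

  mulˡ-≤ : ∀ {a b} r → 0ℚ ≤ r → a ≤ b → r * a ≤ r * b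
  mulˡ-≤ r 0≤r = ℚP.*-monoˡ-≤-nonNeg r {{ℚ.nonNegative 0≤r}}

  mulʳ-< : ∀ {a b} r → 0ℚ < r → a < b → a * r < b * r
  mulʳ-< r 0<r = ℚP.*-monoˡ-<-pos r {{ℚ.positive 0<r}}

  mul-≤ : ∀ {a b c d} → 0ℚ ≤ a → 0ℚ ≤ d → a ≤ b → c ≤ d → a * c ≤ b * d
  mul-≤ {a} {d = d} 0≤a 0≤d a≤b c≤d = ℚP.≤-trans (mulˡ-≤ a 0≤a c≤d) (mulʳ-≤ d 0≤d a≤b)

  nonNeg-* : ∀ {a b} → 0ℚ ≤ a → 0ℚ ≤ b → 0ℚ ≤ a * b
  nonNeg-* {a} {b} 0≤a 0≤b = subst (_≤ a * b) (ℚP.*-zeroʳ a) (mulˡ-≤ a 0≤a 0≤b)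

  ≤-+-nonNeg : ∀ a {z} → 0ℚ ≤ z → a ≤ a + z
  ≤-+-nonNeg a {z} 0≤z = subst (_≤ a + z) (ℚP.+-identityʳ a) (ℚP.+-monoʳ-≤ a 0≤z)

  <⇒≱ : ∀ {a b} → a < b → ¬ (b ≤ a)
  <⇒≱ a<b b≤a = ℚP.<-irrefl refl (ℚP.<-≤-trans a<b b≤a)

  square-cancel-≤ : ∀ {a b} → 0ℚ ≤ a → 0ℚ ≤ b → a * a ≤ b * b → a ≤ b
  square-cancel-≤ {a} {b} 0≤a 0≤b aa≤bb with a ℚP.≤? b
  ... | yes a≤b = a≤b
  ... | no a≰b = contradiction aa≤bb
        (<⇒≱ (ℚP.≤-<-trans (mulˡ-≤ b 0≤b (ℚP.<⇒≤ b<a)) (mulʳ-< a (ℚP.≤-<-trans 0≤b b<a) b<a)))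
    where b<a = ℚP.≰⇒> a≰b

  square-cancel-< : ∀ {a b} → 0ℚ ≤ b → a * a < b * b → a < b
  square-cancel-< {a} {b} 0≤b aa<bb with b ℚP.≤? a
  ... | yes b≤a = contradiction (mul-≤ 0≤b (ℚP.≤-trans 0≤b b≤a) b≤a b≤a) (<⇒≱ aa<bb)
  ... | no b≰a = ℚP.≰⇒> b≰a

  1/-nonNeg : ∀ c (0<c : 0ℚ < c) → 0ℚ ≤ (ℚ.1/ c) {{ℚ.>-nonZero 0<c}}
  1/-nonNeg c 0<c = ℚP.<⇒≤ (ℚP.positive⁻¹ _ {{ℚP.1/pos⇒pos c {{ℚ.positive 0<c}}}})

-- The hypothesis IsCeilCSqrt c N′ X pins X down to within a constant of p/K:
-- from  c²N′ ≤ X²,  (X-1)² < c²N′  and  y² ≤ N′ < y² + 1  for y = p/(cK)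
-- one gets  cy ≤ X < cy + c + 1,  i.e.  p ≤ X·K < p + (c+1)·K.
module SizeOfX where

  open import Data.Nat as ℕ using (ℕ; zero; suc)
  import Data.Nat.Properties as ℕP
  open import Data.Rational as ℚ using (ℚ; 0ℚ; 1ℚ; _≤_; _<_; _+_; _*_; _÷_; >-nonZero)
  import Data.Rational.Properties as ℚP
  open import Relation.Binary.PropositionalEquality
  open import Data.Product using (_×_; _,_; proj₁; proj₂)
  open import Data.Rational.Solver using (module +-*-Solver)
  open +-*-Solver
  open Cast
  open Ceiling
  open RationalOrder

  X≤pred+1 : ∀ X → X ℕ.≤ (X ℕ.∸ 1) ℕ.+ 1
  X≤pred+1 zero = ℕ.z≤n
  X≤pred+1 (suc k) = ℕP.≤-reflexive (ℕP.+-comm 1 k)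

  X-bounds : (c K : ℚ) (c>0 : 0ℚ < c) (K>0 : 0ℚ < K) (p X : ℕ) →
    IsCeilCSqrt c (N′ c K c>0 K>0 p) X →
    (toℚ p ≤ toℚ X * K) × (toℚ X * K < toℚ p + (c + 1ℚ) * K)
  X-bounds c K c>0 K>0 p X (c²N≤X² , [X-1]²<c²N) = p≤XK , XK<p+[c+1]K
    where
    instance
      c≢0 = >-nonZero c>0
      K≢0 = >-nonZero K>0
    P = toℚ p
    Xq = toℚ X
    y = (P ÷ c) ÷ K
    0≤c = ℚP.<⇒≤ c>0
    0≤K = ℚP.<⇒≤ K>0
    0≤y : 0ℚ ≤ y
    0≤y = nonNeg-* (nonNeg-* (toℚ-nonNeg p) (1/-nonNeg c c>0)) (1/-nonNeg K K>0)
    0≤cc = nonNeg-* 0≤c 0≤c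
    0≤KK = nonNeg-* 0≤K 0≤K
    N-bounds = ceiling-bounds (y * y) (nonNeg-* 0≤y 0≤y)

    cyK≡p : c * y * K ≡ P
    cyK≡p = begin
      c * y * K
        ≡⟨ solve 5 (λ c P ic K iK → c :* ((P :* ic) :* iK) :* K := P :* (c :* ic) :* (K :* iK)) refl c P (ℚ.1/ c) K (ℚ.1/ K) ⟩
      P * (c * ℚ.1/ c) * (K * ℚ.1/ K)
        ≡⟨ cong₂ (λ u v → P * u * v) (ℚP.*-inverseʳ c) (ℚP.*-inverseʳ K) ⟩
      P * 1ℚ * 1ℚ
        ≡⟨ solve 1 (λ P → P :* con 1ℚ :* con 1ℚ := P) refl P ⟩
      P ∎
      where open ≡-Reasoning

    p≤XK : P ≤ Xq * K
    p≤XK = square-cancel-≤ (toℚ-nonNeg p) (nonNeg-* (toℚ-nonNeg X) 0≤K) (begin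
      P * P
        ≡⟨ cong₂ _*_ (sym cyK≡p) (sym cyK≡p) ⟩
      (c * y * K) * (c * y * K)
        ≡⟨ solve 3 (λ c y K → (c :* y :* K) :* (c :* y :* K) := c :* c :* (y :* y) :* (K :* K)) refl c y K ⟩
      c * c * (y * y) * (K * K)
        ≤⟨ mulʳ-≤ (K * K) 0≤KK (mulˡ-≤ (c * c) 0≤cc (proj₁ N-bounds)) ⟩
      c * c * toℚ (N′ c K c>0 K>0 p) * (K * K)
        ≤⟨ mulʳ-≤ (K * K) 0≤KK c²N≤X² ⟩
      Xq * Xq * (K * K)
        ≡⟨ solve 2 (λ x K → x :* x :* (K :* K) := (x :* K) :* (x :* K)) refl Xq K ⟩
      (Xq * K) * (Xq * K) ∎)
      where open ℚP.≤-Reasoning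

    X-1<cy+c : toℚ (X ℕ.∸ 1) < c * y + c
    X-1<cy+c = square-cancel-< (ℚP.+-mono-≤ (nonNeg-* 0≤c 0≤y) 0≤c) (begin-strict
      toℚ (X ℕ.∸ 1) * toℚ (X ℕ.∸ 1)
        <⟨ [X-1]²<c²N ⟩
      c * c * toℚ (N′ c K c>0 K>0 p)
        ≤⟨ mulˡ-≤ (c * c) 0≤cc (ℚP.<⇒≤ (proj₂ N-bounds)) ⟩
      c * c * (y * y + 1ℚ)
        ≡⟨ solve 2 (λ c y → c :* c :* (y :* y :+ con 1ℚ) := c :* c :* (y :* y) :+ c :* c) refl c y ⟩
      c * c * (y * y) + c * c
        ≤⟨ ≤-+-nonNeg (c * c * (y * y) + c * c) (nonNeg-* (ℚP.+-mono-≤ 0≤c 0≤c) (nonNeg-* 0≤c 0≤y)) ⟩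
      c * c * (y * y) + c * c + (c + c) * (c * y)
        ≡⟨ solve 2 (λ c y → c :* c :* (y :* y) :+ c :* c :+ (c :+ c) :* (c :* y) := (c :* y :+ c) :* (c :* y :+ c)) refl c y ⟩
      (c * y + c) * (c * y + c) ∎)
      where open ℚP.≤-Reasoning

    XK<p+[c+1]K : Xq * K < P + (c + 1ℚ) * K
    XK<p+[c+1]K = begin-strict
      Xq * K
        ≤⟨ mulʳ-≤ K 0≤K (subst (Xq ≤_) (toℚ-+ (X ℕ.∸ 1) 1) (toℚ-mono-≤ (X≤pred+1 X))) ⟩
      (toℚ (X ℕ.∸ 1) + 1ℚ) * K
        <⟨ mulʳ-< K K>0 (ℚP.+-monoˡ-< 1ℚ X-1<cy+c) ⟩
      (c * y + c + 1ℚ) * K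
        ≡⟨ solve 3 (λ c y K → (c :* y :+ c :+ con 1ℚ) :* K := c :* y :* K :+ (c :+ con 1ℚ) :* K) refl c y K ⟩
      c * y * K + (c + 1ℚ) * K
        ≡⟨ cong (_+ (c + 1ℚ) * K) cyK≡p ⟩
      P + (c + 1ℚ) * K ∎
      where open ℚP.≤-Reasoning

module FiniteSums where

  open import Data.Nat using (ℕ; suc; _+_; _*_; _≤_; _<_; _≟_; z≤n)
  import Data.Nat.Properties as ℕP
  open import Data.Nat.ListAction using (sum)
  open import Data.Nat.Solver using (module +-*-Solver)
  open import Data.Fin as Fin using (Fin; toℕ; fromℕ<)
  import Data.Fin.Properties as FinP
  open import Data.List using (List; []; _∷_; map; filter; length; lookup; upTo; cartesianProduct; _++_)
  import Data.List.Properties as LP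
  open import Data.List.Relation.Unary.All as All using (All; []; _∷_)
  import Data.List.Relation.Unary.All.Properties as AllP
  open import Data.List.Relation.Unary.Any using (here; there)
  open import Data.List.Relation.Unary.Unique.Propositional using (Unique; []; _∷_)
  import Data.List.Relation.Unary.Unique.Propositional.Properties as UniqueP
  open import Data.List.Membership.Propositional using (_∈_; _∉_)
  import Data.List.Membership.Propositional.Properties as ∈P
  open import Relation.Binary.PropositionalEquality
  open import Relation.Nullary using (yes; no; ¬_)
  open import Relation.Nullary.Negation using (contradiction)
  open import Data.Product using (_×_; _,_; proj₁; proj₂)
  open import Data.Empty using (⊥-elim)
  open import Function using (_∘_)

  module _ {A : Set} where

    sum-+ : ∀ (f g : A → ℕ) xs → sum (map (λ v → f v + g v) xs) ≡ sum (map f xs) + sum (map g xs)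
    sum-+ f g [] = refl
    sum-+ f g (x ∷ xs) = trans (cong (f x + g x +_) (sum-+ f g xs)) (interchange (f x) (g x) _ _)
      where
      open +-*-Solver
      interchange : ∀ a b c d → (a + b) + (c + d) ≡ (a + c) + (b + d)
      interchange = solve 4 (λ a b c d → (a :+ b) :+ (c :+ d) := (a :+ c) :+ (b :+ d)) refl

    sum-* : ∀ k (f : A → ℕ) xs → sum (map (λ v → k * f v) xs) ≡ k * sum (map f xs)
    sum-* k f [] = sym (ℕP.*-zeroʳ k)
    sum-* k f (x ∷ xs) = trans (cong (k * f x +_) (sum-* k f xs)) (sym (ℕP.*-distribˡ-+ k (f x) _))

    sum-mono : ∀ (f g : A → ℕ) xs → (∀ v → f v ≤ g v) → sum (map f xs) ≤ sum (map g xs)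
    sum-mono f g [] _ = z≤n
    sum-mono f g (x ∷ xs) f≤g = ℕP.+-mono-≤ (f≤g x) (sum-mono f g xs f≤g)

    sum-cong : ∀ (f g : A → ℕ) xs → (∀ v → f v ≡ g v) → sum (map f xs) ≡ sum (map g xs)
    sum-cong f g xs f≡g = cong sum (LP.map-cong f≡g xs)

    sum-zero : ∀ (xs : List A) → sum (map (λ _ → 0) xs) ≡ 0
    sum-zero [] = refl
    sum-zero (x ∷ xs) = sum-zero xs

    sum-one : ∀ (xs : List A) → sum (map (λ _ → 1) xs) ≡ length xs
    sum-one [] = refl
    sum-one (x ∷ xs) = cong suc (sum-one xs)

  indicator : ℕ → ℕ → ℕ
  indicator y v with y ≟ v
  ... | yes _ = 1
  ... | no _ = 0

  indicator-≡ : ∀ {y v} → y ≡ v → indicator y v ≡ 1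
  indicator-≡ {y} {v} y≡v with y ≟ v
  ... | yes _ = refl
  ... | no y≢v = contradiction y≡v y≢v

  indicator-≢ : ∀ {y v} → ¬ y ≡ v → indicator y v ≡ 0
  indicator-≢ {y} {v} y≢v with y ≟ v
  ... | yes y≡v = contradiction y≡v y≢v
  ... | no _ = refl

  sift-∉ : ∀ y (h : ℕ → ℕ) vs → y ∉ vs → sum (map (λ v → indicator y v * h v) vs) ≡ 0
  sift-∉ y h [] _ = refl
  sift-∉ y h (v ∷ vs) y∉ = cong₂ _+_ (cong (_* h v) (indicator-≢ (y∉ ∘ here))) (sift-∉ y h vs (y∉ ∘ there))

  sift : ∀ y (h : ℕ → ℕ) vs → Unique vs → y ∈ vs → sum (map (λ v → indicator y v * h v) vs) ≡ h y
  sift y h (v ∷ vs) (v∉ ∷ _) (here refl) = begin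
    indicator y y * h y + sum (map (λ v → indicator y v * h v) vs)
      ≡⟨ cong₂ _+_ (cong (_* h y) (indicator-≡ {y} refl)) (sift-∉ y h vs (AllP.All¬⇒¬Any v∉)) ⟩
    h y + 0 + 0
      ≡⟨ trans (ℕP.+-identityʳ _) (ℕP.+-identityʳ (h y)) ⟩
    h y ∎
    where open ≡-Reasoning
  sift y h (v ∷ vs) (v∉ ∷ u) (there y∈) =
    cong₂ _+_ (cong (_* h v) (indicator-≢ (λ y≡v → AllP.All¬⇒¬Any v∉ (subst (_∈ vs) y≡v y∈)))) (sift y h vs u y∈)

  fibre : (ℕ → ℕ) → List ℕ → ℕ → ℕ
  fibre e L v = length (filter (λ u → e u ≟ v) L)

  fibre-∷ : ∀ e u L v → fibre e (u ∷ L) v ≡ indicator (e u) v + fibre e L v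
  fibre-∷ e u L v with e u ≟ v
  ... | yes eu≡v rewrite LP.filter-accept (λ w → e w ≟ v) {xs = L} eu≡v = refl
  ... | no eu≢v rewrite LP.filter-reject (λ w → e w ≟ v) {xs = L} eu≢v = refl

  sum-over-fibres : ∀ p (e h : ℕ → ℕ) L → All (λ u → e u < p) L →
    sum (map (λ v → fibre e L v * h v) (upTo p)) ≡ sum (map (h ∘ e) L)
  sum-over-fibres p e h [] _ = sum-zero (upTo p)
  sum-over-fibres p e h (u ∷ L) (eu<p ∷ e[L]<p) = begin
    sum (map (λ v → fibre e (u ∷ L) v * h v) (upTo p))
      ≡⟨ sum-cong _ _ (upTo p) (λ v → trans (cong (_* h v) (fibre-∷ e u L v)) (ℕP.*-distribʳ-+ (h v) (indicator (e u) v) _)) ⟩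
    sum (map (λ v → indicator (e u) v * h v + fibre e L v * h v) (upTo p))
      ≡⟨ sum-+ (λ v → indicator (e u) v * h v) (λ v → fibre e L v * h v) (upTo p) ⟩
    sum (map (λ v → indicator (e u) v * h v) (upTo p)) + sum (map (λ v → fibre e L v * h v) (upTo p))
      ≡⟨ cong₂ _+_ (sift (e u) h (upTo p) (UniqueP.upTo⁺ p) (∈P.∈-upTo⁺ eu<p)) (sum-over-fibres p e h L e[L]<p) ⟩
    h (e u) + sum (map (h ∘ e) L) ∎
    where open ≡-Reasoning

  count-pairs : ∀ (P Q : ℕ → ℕ → ℕ) (L M : List ℕ) →
    length (filter (λ uw → P (proj₁ uw) (proj₂ uw) ≟ Q (proj₁ uw) (proj₂ uw)) (cartesianProduct L M)) ≡
    sum (map (λ u → length (filter (λ w → P u w ≟ Q u w) M)) L)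
  count-pairs P Q [] M = refl
  count-pairs P Q (u ∷ L) M = begin
    length (filter R? (map (u ,_) M ++ cartesianProduct L M))
      ≡⟨ cong length (LP.filter-++ R? (map (u ,_) M) (cartesianProduct L M)) ⟩
    length (filter R? (map (u ,_) M) ++ filter R? (cartesianProduct L M))
      ≡⟨ LP.length-++ (filter R? (map (u ,_) M)) ⟩
    length (filter R? (map (u ,_) M)) + length (filter R? (cartesianProduct L M))
      ≡⟨ cong₂ _+_ (row M) (count-pairs P Q L M) ⟩
    length (filter (λ w → P u w ≟ Q u w) M) + sum (map (λ u → length (filter (λ w → P u w ≟ Q u w) M)) L) ∎
    where
    open ≡-Reasoning
    R? = λ (uw : ℕ × ℕ) → P (proj₁ uw) (proj₂ uw) ≟ Q (proj₁ uw) (proj₂ uw)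
    row : ∀ M → length (filter R? (map (u ,_) M)) ≡ length (filter (λ w → P u w ≟ Q u w) M)
    row [] = refl
    row (w ∷ M) with P u w ≟ Q u w
    ... | yes eq rewrite LP.filter-accept R? {x = u , w} {xs = map (u ,_) M} eq
                       | LP.filter-accept (λ w → P u w ≟ Q u w) {xs = M} eq = cong suc (row M)
    ... | no ne rewrite LP.filter-reject R? {x = u , w} {xs = map (u ,_) M} ne
                      | LP.filter-reject (λ w → P u w ≟ Q u w) {xs = M} ne = row M

  lookup-injective : ∀ {A : Set} {xs : List A} → Unique xs → ∀ i j → lookup xs i ≡ lookup xs j → i ≡ j
  lookup-injective (_ ∷ _) Fin.zero Fin.zero _ = refl
  lookup-injective (x∉ ∷ _) Fin.zero (Fin.suc j) x≡ = ⊥-elim (All.lookup x∉ (∈P.∈-lookup j) x≡)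
  lookup-injective (x∉ ∷ _) (Fin.suc i) Fin.zero ≡x = ⊥-elim (All.lookup x∉ (∈P.∈-lookup i) (sym ≡x))
  lookup-injective (_ ∷ u) (Fin.suc i) (Fin.suc j) eq = cong Fin.suc (lookup-injective u i j eq)

  injection-bound : ∀ {A : Set} (f : A → ℕ) N xs → Unique xs → All (λ x → f x < N) xs →
    (∀ {x y} → x ∈ xs → y ∈ xs → f x ≡ f y → x ≡ y) → length xs ≤ N
  injection-bound f N xs uniq f<N f-inj = ℕP.≮⇒≥ λ N<len →
    let i , j , i<j , gi≡gj = FinP.pigeonhole N<len g in
    FinP.<⇒≢ i<j (lookup-injective uniq i j (f-inj (∈P.∈-lookup i) (∈P.∈-lookup j)
      (trans (sym (FinP.toℕ-fromℕ< (lookup<N i))) (trans (cong toℕ gi≡gj) (FinP.toℕ-fromℕ< (lookup<N j))))))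
    where
    lookup<N : ∀ i → f (lookup xs i) < N
    lookup<N i = All.lookup f<N (∈P.∈-lookup i)
    g : Fin (length xs) → Fin N
    g i = fromℕ< (lookup<N i)

module CountVectors where

  open import Data.Nat as ℕ using (ℕ; zero; suc; _+_; _*_; _∸_; _≤_; _≟_; z≤n; NonZero)
  import Data.Nat.Properties as ℕP
  open import Data.Nat.DivMod using (_%_; m%n<n)
  open import Data.Nat.ListAction using (sum)
  open import Data.List using (List; map; filter; length; upTo; cartesianProduct)
  import Data.List.Properties as LP
  open import Data.List.Relation.Unary.All as All using (All)
  open import Relation.Binary.PropositionalEquality
  open import Data.Sum using (inj₁; inj₂)
  open import Data.Product using (_×_; proj₁; proj₂)
  open import Data.Nat.Solver using (module +-*-Solver)
  open FiniteSums

  sum≤dist+2prod-≤ : ∀ x y → x ≤ y → x + y ≤ ℕ.∣ x - y ∣ + 2 * (x * y)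
  sum≤dist+2prod-≤ x zero z≤n = z≤n
  sum≤dist+2prod-≤ x y@(suc _) x≤y = begin
    x + y                       ≡⟨ cong (x +_) (sym (ℕP.m+[n∸m]≡n x≤y)) ⟩
    x + (x + (y ∸ x))           ≡⟨ solve 2 (λ x d → x :+ (x :+ d) := d :+ con 2 :* x) refl x (y ∸ x) ⟩
    (y ∸ x) + 2 * x             ≤⟨ ℕP.+-mono-≤ (ℕP.≤-reflexive (sym (ℕP.m≤n⇒∣m-n∣≡n∸m x≤y))) (ℕP.*-monoʳ-≤ 2 (ℕP.m≤m*n x y)) ⟩
    ℕ.∣ x - y ∣ + 2 * (x * y)   ∎
    where
    open ℕP.≤-Reasoning
    open +-*-Solver

  sum≤dist+2prod : ∀ x y → x + y ≤ ℕ.∣ x - y ∣ + 2 * (x * y)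
  sum≤dist+2prod x y with ℕP.≤-total x y
  ... | inj₁ x≤y = sum≤dist+2prod-≤ x y x≤y
  ... | inj₂ y≤x = subst₂ _≤_ (ℕP.+-comm y x) (cong₂ (λ u v → u + 2 * v) (ℕP.∣-∣-comm y x) (ℕP.*-comm y x))
                     (sum≤dist+2prod-≤ y x y≤x)

  module _ (p : ℕ) .{{_ : NonZero p}} (X : ℕ) where

    support : List ℕ
    support = map suc (upTo X)

    collisions : ℕ → ℕ → ℕ
    collisions r s = sum (map (λ v → count p X r v * count p X s v) (upTo p))

    l1-distance : ℕ → ℕ → ℕ
    l1-distance r s = sum (map (λ v → ℕ.∣ count p X r v - count p X s v ∣) (upTo p))

    solutions : ℕ → ℕ → List (ℕ × ℕ)
    solutions r s = filter (λ (uw : ℕ × ℕ) → (s * proj₂ uw) % p ≟ (r * proj₁ uw) % p) (cartesianProduct support support)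

    residues<p : ∀ r → All (λ u → (r * u) % p ℕ.< p) support
    residues<p r = All.tabulate (λ {u} _ → m%n<n (r * u) p)

    counts-sum : ∀ r → sum (map (count p X r) (upTo p)) ≡ X
    counts-sum r = begin
      sum (map (count p X r) (upTo p))
        ≡⟨ sum-cong (count p X r) (λ v → count p X r v * 1) (upTo p) (λ v → sym (ℕP.*-identityʳ _)) ⟩
      sum (map (λ v → count p X r v * 1) (upTo p))
        ≡⟨ sum-over-fibres p (λ u → (r * u) % p) (λ _ → 1) support (residues<p r) ⟩
      sum (map (λ _ → 1) support)
        ≡⟨ sum-one support ⟩
      length support
        ≡⟨ trans (LP.length-map suc (upTo X)) (LP.length-upTo X) ⟩
      X ∎
      where open ≡-Reasoning

    collisions≡solutions : ∀ r s → collisions r s ≡ length (solutions r s)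
    collisions≡solutions r s = trans (sum-over-fibres p (λ u → (r * u) % p) (count p X s) support (residues<p r))
      (sym (count-pairs (λ u w → (s * w) % p) (λ u w → (r * u) % p) support support))

    collisions-sym : ∀ r s → collisions r s ≡ collisions s r
    collisions-sym r s = sum-cong _ _ (upTo p) (λ v → ℕP.*-comm (count p X r v) (count p X s v))

    2X≤l1+2collisions : ∀ r s → 2 * X ≤ l1-distance r s + 2 * collisions r s
    2X≤l1+2collisions r s = begin
      2 * X
        ≡⟨ cong₂ _+_ (sym (counts-sum r)) (trans (ℕP.+-identityʳ X) (sym (counts-sum s))) ⟩
      sum (map (count p X r) (upTo p)) + sum (map (count p X s) (upTo p))
        ≡⟨ sym (sum-+ (count p X r) (count p X s) (upTo p)) ⟩
      sum (map (λ v → count p X r v + count p X s v) (upTo p))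
        ≤⟨ sum-mono _ _ (upTo p) (λ v → sum≤dist+2prod (count p X r v) (count p X s v)) ⟩
      sum (map (λ v → ℕ.∣ count p X r v - count p X s v ∣ + 2 * (count p X r v * count p X s v)) (upTo p))
        ≡⟨ sum-+ _ _ (upTo p) ⟩
      l1-distance r s + sum (map (λ v → 2 * (count p X r v * count p X s v)) (upTo p))
        ≡⟨ cong (l1-distance r s +_) (sum-* 2 (λ v → count p X r v * count p X s v) (upTo p)) ⟩
      l1-distance r s + 2 * collisions r s ∎
      where open ℕP.≤-Reasoning

module TotalVariation where

  open import Data.Nat as ℕ using (ℕ; suc; NonZero)
  import Data.Nat.Properties as ℕP
  open import Data.Nat.ListAction using (sum)
  open import Data.Integer as ℤ using (+_)
  open import Data.Rational as ℚ using (ℚ; 0ℚ; 1ℚ; ½; _≤_; _<_; _+_; _-_; _*_; ∣_∣; >-nonZero)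
  import Data.Rational.Properties as ℚP
  open import Data.List using (List; []; _∷_; map; upTo)
  open import Relation.Binary.PropositionalEquality
  open import Data.Sum using (inj₁; inj₂)
  open import Data.List.Membership.Propositional using (_∈_)
  open import Relation.Binary.Definitions using (tri<; tri≈; tri>)
  open import Relation.Nullary.Negation using (contradiction)
  open import Data.Rational.Solver using (module +-*-Solver)
  open +-*-Solver
  open Cast
  open RationalOrder
  open CountVectors

  ∣-∣-cast-≤ : ∀ x y → x ℕ.≤ y → ∣ toℚ x - toℚ y ∣ ≡ toℚ ℕ.∣ x - y ∣
  ∣-∣-cast-≤ x y x≤y = begin
    ∣ toℚ x - toℚ y ∣
      ≡⟨ cong (λ z → ∣ toℚ x - z ∣) (trans (cong toℚ (sym (ℕP.m+[n∸m]≡n x≤y))) (toℚ-+ x (y ℕ.∸ x))) ⟩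
    ∣ toℚ x - (toℚ x + toℚ (y ℕ.∸ x)) ∣
      ≡⟨ cong ∣_∣ (solve 2 (λ a d → a :- (a :+ d) := :- d) refl (toℚ x) (toℚ (y ℕ.∸ x))) ⟩
    ∣ ℚ.- toℚ (y ℕ.∸ x) ∣
      ≡⟨ trans (ℚP.∣-p∣≡∣p∣ (toℚ (y ℕ.∸ x))) (ℚP.0≤p⇒∣p∣≡p (toℚ-nonNeg (y ℕ.∸ x))) ⟩
    toℚ (y ℕ.∸ x)
      ≡⟨ cong toℚ (sym (ℕP.m≤n⇒∣m-n∣≡n∸m x≤y)) ⟩
    toℚ ℕ.∣ x - y ∣ ∎
    where open ≡-Reasoning

  ∣-∣-cast : ∀ x y → ∣ toℚ x - toℚ y ∣ ≡ toℚ ℕ.∣ x - y ∣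
  ∣-∣-cast x y with ℕP.≤-total x y
  ... | inj₁ x≤y = ∣-∣-cast-≤ x y x≤y
  ... | inj₂ y≤x = begin
    ∣ toℚ x - toℚ y ∣      ≡⟨ cong ∣_∣ (solve 2 (λ a b → a :- b := :- (b :- a)) refl (toℚ x) (toℚ y)) ⟩
    ∣ ℚ.- (toℚ y - toℚ x) ∣ ≡⟨ ℚP.∣-p∣≡∣p∣ (toℚ y - toℚ x) ⟩
    ∣ toℚ y - toℚ x ∣      ≡⟨ ∣-∣-cast-≤ y x y≤x ⟩
    toℚ ℕ.∣ y - x ∣        ≡⟨ cong toℚ (ℕP.∣-∣-comm y x) ⟩
    toℚ ℕ.∣ x - y ∣        ∎
    where open ≡-Reasoning

  sum-∣-∣-scaled : ∀ k (f g : ℕ → ℕ) vs →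
    sumℚ (map (λ v → ∣ (+ f v) ℚ./ suc k - (+ g v) ℚ./ suc k ∣) vs) ≡
    toℚ (sum (map (λ v → ℕ.∣ f v - g v ∣) vs)) * recip k
  sum-∣-∣-scaled k f g [] = sym (ℚP.*-zeroˡ (recip k))
  sum-∣-∣-scaled k f g (v ∷ vs) = begin
    term v + sumℚ (map term vs)
      ≡⟨ cong₂ _+_ term≡ (sum-∣-∣-scaled k f g vs) ⟩
    toℚ ℕ.∣ f v - g v ∣ * recip k + toℚ rest * recip k
      ≡⟨ sym (ℚP.*-distribʳ-+ (recip k) (toℚ ℕ.∣ f v - g v ∣) (toℚ rest)) ⟩
    (toℚ ℕ.∣ f v - g v ∣ + toℚ rest) * recip k
      ≡⟨ cong (_* recip k) (sym (toℚ-+ ℕ.∣ f v - g v ∣ rest)) ⟩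
    toℚ (ℕ.∣ f v - g v ∣ ℕ.+ rest) * recip k ∎
    where
    open ≡-Reasoning
    term : ℕ → ℚ
    term v = ∣ (+ f v) ℚ./ suc k - (+ g v) ℚ./ suc k ∣
    rest = sum (map (λ v → ℕ.∣ f v - g v ∣) vs)
    term≡ : term v ≡ toℚ ℕ.∣ f v - g v ∣ * recip k
    term≡ = begin
      ∣ (+ f v) ℚ./ suc k - (+ g v) ℚ./ suc k ∣
        ≡⟨ cong₂ (λ a b → ∣ a - b ∣) (/-as-recip (f v) k) (/-as-recip (g v) k) ⟩
      ∣ toℚ (f v) * recip k - toℚ (g v) * recip k ∣
        ≡⟨ cong ∣_∣ (solve 3 (λ a b i → a :* i :- b :* i := (a :- b) :* i) refl (toℚ (f v)) (toℚ (g v)) (recip k)) ⟩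
      ∣ (toℚ (f v) - toℚ (g v)) * recip k ∣
        ≡⟨ ℚP.∣p*q∣≡∣p∣*∣q∣ (toℚ (f v) - toℚ (g v)) (recip k) ⟩
      ∣ toℚ (f v) - toℚ (g v) ∣ * ∣ recip k ∣
        ≡⟨ cong₂ _*_ (∣-∣-cast (f v) (g v)) (ℚP.0≤p⇒∣p∣≡p (recip-nonNeg k)) ⟩
      toℚ ℕ.∣ f v - g v ∣ * recip k ∎

  dTV≡l1 : ∀ p .{{_ : NonZero p}} k q q′ → dTV p (suc k) q q′ ≡ ½ * (toℚ (l1-distance p (suc k) q q′) * recip k)
  dTV≡l1 p k q q′ = cong (½ *_) (sum-∣-∣-scaled k (count p (suc k) q) (count p (suc k) q′) (upTo p))

  bound≤half-l1 : ∀ K (K>0 : 0ℚ < K) k D C → 2 ℕ.* suc k ℕ.≤ D ℕ.+ 2 ℕ.* C →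
    toℚ C * K ≤ toℚ 3 * toℚ (suc k) → bound K K>0 ≤ ½ * (toℚ D * recip k)
  bound≤half-l1 K K>0 k D C 2X≤D+2C CK≤3X = begin
    1ℚ - toℚ 3 * 1/K         ≤⟨ ℚP.+-monoʳ-≤ 1ℚ (ℚP.neg-antimono-≤ C/X≤3/K) ⟩
    1ℚ - Cq * recip k        ≡⟨ cong (_- Cq * recip k) (sym (recip-inverse k)) ⟩
    Xq * recip k - Cq * recip k
      ≡⟨ solve 3 (λ X C ι → X :* ι :- C :* ι := con ½ :* ((con (toℚ 2) :* X :- con (toℚ 2) :* C) :* ι)) refl Xq Cq (recip k) ⟩
    ½ * ((toℚ 2 * Xq - toℚ 2 * Cq) * recip k)
      ≤⟨ mulˡ-≤ ½ (ℚP.<⇒≤ (ℚ.*<* (ℤ.+<+ (ℕ.s≤s ℕ.z≤n)))) (mulʳ-≤ (recip k) (recip-nonNeg k) 2X-2C≤D) ⟩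
    ½ * (Dq * recip k)       ∎
    where
    open ℚP.≤-Reasoning
    instance K≢0 = >-nonZero K>0
    1/K = ℚ.1/ K
    Xq = toℚ (suc k)
    Cq = toℚ C
    Dq = toℚ D
    C/X≤3/K : Cq * recip k ≤ toℚ 3 * 1/K
    C/X≤3/K = begin
      Cq * recip k
        ≡⟨ sym (trans (solve 4 (λ C K i ι → C :* K :* i :* ι := C :* ι :* (K :* i)) refl Cq K 1/K (recip k))
                 (trans (cong (Cq * recip k *_) (ℚP.*-inverseʳ K)) (ℚP.*-identityʳ _))) ⟩
      Cq * K * 1/K * recip k
        ≤⟨ mulʳ-≤ (recip k) (recip-nonNeg k) (mulʳ-≤ 1/K (1/-nonNeg K K>0) CK≤3X) ⟩
      toℚ 3 * Xq * 1/K * recip k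
        ≡⟨ solve 4 (λ t X i ι → t :* X :* i :* ι := t :* i :* (X :* ι)) refl (toℚ 3) Xq 1/K (recip k) ⟩
      toℚ 3 * 1/K * (Xq * recip k)
        ≡⟨ trans (cong (toℚ 3 * 1/K *_) (recip-inverse k)) (ℚP.*-identityʳ _) ⟩
      toℚ 3 * 1/K ∎
    2X-2C≤D : toℚ 2 * Xq - toℚ 2 * Cq ≤ Dq
    2X-2C≤D = subst (toℚ 2 * Xq - toℚ 2 * Cq ≤_) (solve 2 (λ D P → D :+ P :- P := D) refl Dq (toℚ 2 * Cq))
      (ℚP.+-monoˡ-≤ (ℚ.- (toℚ 2 * Cq))
        (subst₂ _≤_ (toℚ-* 2 (suc k)) (trans (toℚ-+ D (2 ℕ.* C)) (cong (λ z → Dq + z) (toℚ-* 2 C))) (toℚ-mono-≤ 2X≤D+2C)))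

  -- Collisions are symmetric in (r,s), so it suffices to bound them for r < s.
  far-apart : ∀ K (K>0 : 0ℚ < K) p .{{_ : NonZero p}} k (qs : List ℕ) →
    (∀ {r s} → r ℕ.< s → r ∈ qs → s ∈ qs → toℚ (collisions p (suc k) r s) * K ≤ toℚ 3 * toℚ (suc k)) →
    ∀ {q q′} → q ∈ qs → q′ ∈ qs → q ≢ q′ → bound K K>0 ≤ dTV p (suc k) q q′
  far-apart K K>0 p k qs few {q} {q′} q∈ q′∈ q≢q′ = subst (bound K K>0 ≤_) (sym (dTV≡l1 p k q q′))
    (bound≤half-l1 K K>0 k (l1-distance p (suc k) q q′) (collisions p (suc k) q q′) (2X≤l1+2collisions p (suc k) q q′) CK≤3X)
    where
    CK≤3X : toℚ (collisions p (suc k) q q′) * K ≤ toℚ 3 * toℚ (suc k)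
    CK≤3X with ℕP.<-cmp q q′
    ... | tri< q<q′ _ _ = few q<q′ q∈ q′∈
    ... | tri≈ _ q≡q′ _ = contradiction q≡q′ q≢q′
    ... | tri> _ _ q′<q = subst (λ z → toℚ z * K ≤ toℚ 3 * toℚ (suc k)) (collisions-sym p (suc k) q′ q) (few q′<q q′∈ q∈)

module Congruence (p : ℕ) .{{_ : NonZero p}} where

  open import Data.Nat using (ℕ; _+_; _*_; _∸_; _≤_; _<_; NonZero)
  import Data.Nat.Properties as ℕP
  open import Data.Nat.DivMod
  open import Data.Nat.Divisibility using (_∣_; divides)
  open import Data.Nat.Coprimality using (coprime-divisor; prime⇒coprime)
  open import Data.Nat.Primality using (Prime)
  open import Relation.Binary.PropositionalEquality
  open import Data.Sum using (inj₁; inj₂)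
  open import Data.Nat.Solver using (module +-*-Solver)
  open +-*-Solver

  ≡-mod⇒∣∸ : ∀ {x y} → x ≤ y → x % p ≡ y % p → p ∣ y ∸ x
  ≡-mod⇒∣∸ {x} {y} x≤y eq = divides (y / p ∸ x / p) (begin
    y ∸ x                                          ≡⟨ cong₂ _∸_ (m≡m%n+[m/n]*n y p) (m≡m%n+[m/n]*n x p) ⟩
    (y % p + (y / p) * p) ∸ (x % p + (x / p) * p)  ≡⟨ cong (λ z → (y % p + (y / p) * p) ∸ (z + (x / p) * p)) eq ⟩
    (y % p + (y / p) * p) ∸ (y % p + (x / p) * p)  ≡⟨ ℕP.[m+n]∸[m+o]≡n∸o (y % p) _ _ ⟩
    (y / p) * p ∸ (x / p) * p                      ≡⟨ sym (ℕP.*-distribʳ-∸ p (y / p) (x / p)) ⟩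
    (y / p ∸ x / p) * p                            ∎)
    where open ≡-Reasoning

  ∣∸⇒≡-mod : ∀ {x y} → x ≤ y → p ∣ y ∸ x → x % p ≡ y % p
  ∣∸⇒≡-mod {x} {y} x≤y p∣y∸x = sym (trans (cong (_% p) (sym (ℕP.m+[n∸m]≡n x≤y))) (%-remove-+ʳ x p∣y∸x))

  %-absorbˡ : ∀ x y → (x % p + y) % p ≡ (x + y) % p
  %-absorbˡ x y = begin
    (x % p + y) % p          ≡⟨ %-distribˡ-+ (x % p) y p ⟩
    (x % p % p + y % p) % p  ≡⟨ cong (λ z → (z + y % p) % p) (m%n%n≡m%n x p) ⟩
    (x % p + y % p) % p      ≡⟨ sym (%-distribˡ-+ x y p) ⟩
    (x + y) % p              ∎
    where open ≡-Reasoning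

  %-add-complement : ∀ Y c → (Y + c + (p ∸ c % p)) % p ≡ Y % p
  %-add-complement Y c = begin
    (Y + c + (p ∸ c % p)) % p
      ≡⟨ cong (λ z → (Y + z + (p ∸ c % p)) % p) (m≡m%n+[m/n]*n c p) ⟩
    (Y + (c % p + (c / p) * p) + (p ∸ c % p)) % p
      ≡⟨ cong (_% p) (solve 5 (λ Y ρ q p t → Y :+ (ρ :+ q :* p) :+ t := Y :+ q :* p :+ (ρ :+ t)) refl Y (c % p) (c / p) p (p ∸ c % p)) ⟩
    (Y + (c / p) * p + (c % p + (p ∸ c % p))) % p
      ≡⟨ cong (λ z → (Y + (c / p) * p + z) % p) (ℕP.m+[n∸m]≡n (m%n≤n c p)) ⟩
    (Y + (c / p) * p + p) % p
      ≡⟨ cong (_% p) (solve 3 (λ Y q p → Y :+ q :* p :+ p := Y :+ (q :+ con 1) :* p) refl Y (c / p) p) ⟩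
    (Y + (c / p + 1) * p) % p
      ≡⟨ [m+kn]%n≡m%n Y (c / p + 1) p ⟩
    Y % p ∎
    where open ≡-Reasoning

  %-cancel-+ : ∀ Y Z c c′ → (Y + c) % p ≡ (Z + c′) % p → c % p ≡ c′ % p → Y % p ≡ Z % p
  %-cancel-+ Y Z c c′ Y+c≡Z+c′ c≡c′ = begin
    Y % p                            ≡⟨ sym (%-add-complement Y c) ⟩
    (Y + c + (p ∸ c % p)) % p        ≡⟨ sym (%-absorbˡ (Y + c) (p ∸ c % p)) ⟩
    ((Y + c) % p + (p ∸ c % p)) % p  ≡⟨ cong₂ (λ u v → (u + (p ∸ v)) % p) Y+c≡Z+c′ c≡c′ ⟩
    ((Z + c′) % p + (p ∸ c′ % p)) % p ≡⟨ %-absorbˡ (Z + c′) (p ∸ c′ % p) ⟩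
    (Z + c′ + (p ∸ c′ % p)) % p      ≡⟨ %-add-complement Z c′ ⟩
    Z % p                            ∎
    where open ≡-Reasoning

  %-cancel-*ˡ : Prime p → ∀ g .{{_ : NonZero g}} → g < p → ∀ x y → (g * x) % p ≡ (g * y) % p → x % p ≡ y % p
  %-cancel-*ˡ p-prime g g<p x y gx≡gy with ℕP.≤-total x y
  ... | inj₁ x≤y = ∣∸⇒≡-mod x≤y (coprime-divisor (prime⇒coprime p-prime g<p)
        (subst (p ∣_) (sym (ℕP.*-distribˡ-∸ g y x)) (≡-mod⇒∣∸ (ℕP.*-monoʳ-≤ g x≤y) gx≡gy)))
  ... | inj₂ y≤x = sym (∣∸⇒≡-mod y≤x (coprime-divisor (prime⇒coprime p-prime g<p)
        (subst (p ∣_) (sym (ℕP.*-distribˡ-∸ g x y)) (≡-mod⇒∣∸ (ℕP.*-monoʳ-≤ g y≤x) (sym gx≡gy)))))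

-- Writing g = gcd(r,s), a = r/g, b = s/g, a collision (u,w) satisfies
-- b·w ≡ a·u (mod p), so Y = a·u + b·X - b·w lies in [0,(a+b)X] and Y ≡ b·X;
-- hence ⌊Y/p⌋ determines Y.  Two collisions with the same ⌊(u-1)/b⌋ and the same
-- Y satisfy a·u₁ + b·w₂ = a·u₂ + b·w₁ with |u₁ - u₂| < b, which forces equality.
-- Counting the possible codes gives  p·b·C(r,s) ≤ (2bX + p)(X + b).
module Collisions where

  open import Data.Nat as ℕ using (ℕ; suc; _+_; _*_; _∸_; _≤_; _<_; _≟_; z≤n; s≤s; NonZero)
  import Data.Nat.Properties as ℕP
  open import Data.Nat.DivMod
  open import Data.Nat.Divisibility using (_∣_; ∣⇒≤; n∣m*n; ∣m+n∣m⇒∣n)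
  open import Data.Nat.GCD using (gcd; gcd[m,n]∣m; gcd[m,n]∣n; gcd[m,n]≢0)
  open import Data.Nat.Coprimality as Coprimality using (Coprime; coprime-/gcd; coprime-divisor)
  open import Data.Nat.Primality using (Prime)
  open import Data.List using (length)
  import Data.List.Relation.Unary.All as All
  open import Data.List.Relation.Unary.Unique.Propositional using (Unique)
  import Data.List.Relation.Unary.Unique.Propositional.Properties as UniqueP
  open import Data.List.Membership.Propositional using (_∈_)
  import Data.List.Membership.Propositional.Properties as ∈P
  open import Relation.Binary.PropositionalEquality
  open import Relation.Binary.Definitions using (tri<; tri≈; tri>)
  open import Relation.Nullary using (yes; no)
  open import Relation.Nullary.Negation using (contradiction)
  open import Data.Sum using (inj₁; inj₂)
  open import Data.Product as Σ using (_×_; _,_; proj₁; proj₂)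
  open import Data.Nat.Solver using (module +-*-Solver)
  open +-*-Solver
  open FiniteSums using (injection-bound)
  open CountVectors using (support; solutions)

  leading-digit-< : ∀ {n} i₁ i₂ q₁ q₂ → q₁ < n → i₁ < i₂ → i₁ * n + q₁ < i₂ * n + q₂
  leading-digit-< {n} i₁ i₂ q₁ q₂ q₁<n i₁<i₂ = begin-strict
    i₁ * n + q₁    <⟨ ℕP.+-monoʳ-< (i₁ * n) q₁<n ⟩
    i₁ * n + n     ≡⟨ ℕP.+-comm (i₁ * n) n ⟩
    suc i₁ * n     ≤⟨ ℕP.*-monoˡ-≤ n i₁<i₂ ⟩
    i₂ * n         ≤⟨ ℕP.m≤m+n (i₂ * n) q₂ ⟩
    i₂ * n + q₂    ∎
    where open ℕP.≤-Reasoning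

  digits-unique : ∀ {n} i₁ i₂ q₁ q₂ → q₁ < n → q₂ < n → i₁ * n + q₁ ≡ i₂ * n + q₂ → i₁ ≡ i₂ × q₁ ≡ q₂
  digits-unique {n} i₁ i₂ q₁ q₂ q₁<n q₂<n eq with ℕP.<-cmp i₁ i₂
  ... | tri≈ _ refl _ = refl , ℕP.+-cancelˡ-≡ (i₁ * n) q₁ q₂ eq
  ... | tri< i₁<i₂ _ _ = contradiction eq (ℕP.<⇒≢ (leading-digit-< i₁ i₂ q₁ q₂ q₁<n i₁<i₂))
  ... | tri> _ _ i₂<i₁ = contradiction (sym eq) (ℕP.<⇒≢ (leading-digit-< i₂ i₁ q₂ q₁ q₂<n i₂<i₁))

  same-quotient⇒close : ∀ b .{{_ : NonZero b}} {x y} → x ≤ y → x / b ≡ y / b → y ∸ x < b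
  same-quotient⇒close b {x} {y} x≤y eq = ℕP.≤-<-trans (ℕP.≤-reflexive y∸x≡) (ℕP.≤-<-trans (ℕP.m∸n≤m (y % b) (x % b)) (m%n<n y b))
    where
    y∸x≡ : y ∸ x ≡ y % b ∸ x % b
    y∸x≡ = begin
      y ∸ x                                          ≡⟨ cong₂ _∸_ (m≡m%n+[m/n]*n y b) (m≡m%n+[m/n]*n x b) ⟩
      (y % b + (y / b) * b) ∸ (x % b + (x / b) * b)  ≡⟨ cong (λ z → (y % b + (y / b) * b) ∸ (x % b + z * b)) eq ⟩
      (y % b + (y / b) * b) ∸ (x % b + (y / b) * b)  ≡⟨ cong₂ _∸_ (ℕP.+-comm (y % b) _) (ℕP.+-comm (x % b) _) ⟩
      ((y / b) * b + y % b) ∸ ((y / b) * b + x % b)  ≡⟨ ℕP.[m+n]∸[m+o]≡n∸o ((y / b) * b) (y % b) (x % b) ⟩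
      y % b ∸ x % b                                  ∎
      where open ≡-Reasoning

  close-solutions-trivial : ∀ a b .{{_ : NonZero b}} → Coprime b a → ∀ {u₁ u₂ w₁ w₂} →
    u₁ ≤ u₂ → u₂ ∸ u₁ < b → a * u₁ + b * w₂ ≡ a * u₂ + b * w₁ → u₁ ≡ u₂ × w₁ ≡ w₂
  close-solutions-trivial a b cop {u₁} {u₂} {w₁} {w₂} u₁≤u₂ d<b eq = u₁≡u₂ , w₁≡w₂
    where
    d = u₂ ∸ u₁
    u₂≡ : u₂ ≡ u₁ + d
    u₂≡ = sym (ℕP.m+[n∸m]≡n u₁≤u₂)
    bw₂≡ : b * w₂ ≡ b * w₁ + a * d
    bw₂≡ = ℕP.+-cancelˡ-≡ (a * u₁) _ _ (begin
      a * u₁ + b * w₂         ≡⟨ eq ⟩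
      a * u₂ + b * w₁         ≡⟨ cong (λ z → a * z + b * w₁) u₂≡ ⟩
      a * (u₁ + d) + b * w₁   ≡⟨ solve 5 (λ a u d b w → a :* (u :+ d) :+ b :* w := a :* u :+ (b :* w :+ a :* d)) refl a u₁ d b w₁ ⟩
      a * u₁ + (b * w₁ + a * d) ∎)
      where open ≡-Reasoning
    b∣ad : b ∣ a * d
    b∣ad = ∣m+n∣m⇒∣n (subst (b ∣_) (trans (ℕP.*-comm w₂ b) bw₂≡) (n∣m*n w₂)) (subst (b ∣_) (ℕP.*-comm w₁ b) (n∣m*n w₁))
    d≡0 : d ≡ 0
    d≡0 with d ≟ 0
    ... | yes d≡0 = d≡0
    ... | no d≢0 = contradiction (∣⇒≤ {{ℕ.≢-nonZero d≢0}} (coprime-divisor cop b∣ad)) (ℕP.<⇒≱ d<b)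
    u₁≡u₂ : u₁ ≡ u₂
    u₁≡u₂ = sym (trans u₂≡ (trans (cong (u₁ +_) d≡0) (ℕP.+-identityʳ u₁)))
    w₁≡w₂ : w₁ ≡ w₂
    w₁≡w₂ = sym (ℕP.*-cancelˡ-≡ w₂ w₁ b (trans bw₂≡ (trans (cong (λ z → b * w₁ + a * z) d≡0)
              (trans (cong (b * w₁ +_) (ℕP.*-zeroʳ a)) (ℕP.+-identityʳ _)))))

  module Counting (p : ℕ) .{{_ : NonZero p}} (p-prime : Prime p) (X r s : ℕ) .{{_ : NonZero r}}
                  (r<s : r < s) (s<p : s < p) where

    open Congruence p

    g = gcd r s
    instance
      g≢0 : NonZero g
      g≢0 = ℕ.≢-nonZero (gcd[m,n]≢0 r s (inj₁ (ℕ.≢-nonZero⁻¹ r)))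

    a = r / g
    b = s / g

    r≡ag : r ≡ a * g
    r≡ag = sym (m/n*n≡m (gcd[m,n]∣m r s))

    s≡bg : s ≡ b * g
    s≡bg = sym (m/n*n≡m (gcd[m,n]∣n r s))

    b⊥a : Coprime b a
    b⊥a = Coprimality.sym (coprime-/gcd r s)

    a<b : a < b
    a<b = ℕP.*-cancelʳ-< g a b (subst₂ _<_ r≡ag s≡bg r<s)

    instance
      b≢0 : NonZero b
      b≢0 = ℕ.>-nonZero (ℕP.≤-<-trans z≤n a<b)

    g≤s∸r : g ≤ s ∸ r
    g≤s∸r = ∣⇒≤ {{ℕ.>-nonZero (ℕP.m<n⇒0<n∸m r<s)}}
      (∣m+n∣m⇒∣n (subst (g ∣_) (sym (ℕP.m+[n∸m]≡n (ℕP.<⇒≤ r<s))) (gcd[m,n]∣n r s)) (gcd[m,n]∣m r s))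

    in-support : ∀ {x} → x ∈ support p X → 1 ≤ x × x ≤ X
    in-support x∈ with ∈P.∈-map⁻ suc x∈
    ... | k , k∈ , refl = s≤s z≤n , ∈P.∈-upTo⁻ k∈

    solution-facts : ∀ {u w} → (u , w) ∈ solutions p X r s →
      (1 ≤ u × u ≤ X) × (w ≤ X) × ((s * w) % p ≡ (r * u) % p)
    solution-facts u,w∈ with ∈P.∈-filter⁻ _ u,w∈
    ... | u,w∈L×L , congruent with ∈P.∈-cartesianProduct⁻ (support p X) (support p X) u,w∈L×L
    ... | u∈ , w∈ = in-support u∈ , proj₂ (in-support w∈) , congruent

    reduced-congruence : ∀ u w → (s * w) % p ≡ (r * u) % p → (b * w) % p ≡ (a * u) % p
    reduced-congruence u w sw≡ru = %-cancel-*ˡ p-prime g (ℕP.≤-<-trans (∣⇒≤ (gcd[m,n]∣m r s)) (ℕP.<-trans r<s s<p)) (b * w) (a * u)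
      (trans (cong (_% p) (trans (solve 3 (λ g b w → g :* (b :* w) := (b :* g) :* w) refl g b w) (cong (_* w) (sym s≡bg))))
        (trans sw≡ru (cong (_% p) (trans (cong (_* u) r≡ag) (solve 3 (λ g a u → (a :* g) :* u := g :* (a :* u)) refl g a u)))))

    Y : ℕ → ℕ → ℕ
    Y u w = a * u + b * X ∸ b * w

    Y+bw : ∀ u w → w ≤ X → Y u w + b * w ≡ a * u + b * X
    Y+bw u w w≤X = ℕP.m∸n+n≡m (ℕP.≤-trans (ℕP.*-monoʳ-≤ b w≤X) (ℕP.m≤n+m (b * X) (a * u)))

    Y≡bX : ∀ u w → w ≤ X → (s * w) % p ≡ (r * u) % p → Y u w % p ≡ (b * X) % p
    Y≡bX u w w≤X sw≡ru = %-cancel-+ (Y u w) (b * X) (b * w) (a * u)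
      (cong (_% p) (trans (Y+bw u w w≤X) (ℕP.+-comm (a * u) (b * X)))) (reduced-congruence u w sw≡ru)

    Y≤ : ∀ u w → u ≤ X → Y u w ≤ (a + b) * X
    Y≤ u w u≤X = ℕP.≤-trans (ℕP.m∸n≤m (a * u + b * X) (b * w))
      (ℕP.≤-trans (ℕP.+-monoˡ-≤ (b * X) (ℕP.*-monoʳ-≤ a u≤X)) (ℕP.≤-reflexive (sym (ℕP.*-distribʳ-+ X a b))))

    #Y-digits = (a + b) * X / p + 1
    #blocks = (X ∸ 1) / b + 1

    Y-digit< : ∀ u w → u ≤ X → Y u w / p < #Y-digits
    Y-digit< u w u≤X = ℕP.≤-<-trans (/-monoˡ-≤ p (Y≤ u w u≤X)) (ℕP.m<m+n _ (s≤s z≤n))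

    code : ℕ × ℕ → ℕ
    code (u , w) = ((u ∸ 1) / b) * #Y-digits + Y u w / p

    code< : ∀ {x} → x ∈ solutions p X r s → code x < #blocks * #Y-digits
    code< {u , w} u,w∈ = ℕP.<-≤-trans (ℕP.+-monoʳ-< (((u ∸ 1) / b) * #Y-digits) (Y-digit< u w u≤X))
        (ℕP.≤-trans (ℕP.≤-reflexive (ℕP.+-comm (((u ∸ 1) / b) * #Y-digits) #Y-digits)) (ℕP.*-monoˡ-≤ #Y-digits block<))
      where
      u≤X = proj₂ (proj₁ (solution-facts u,w∈))
      block< : suc ((u ∸ 1) / b) ≤ #blocks
      block< = ℕP.≤-trans (s≤s (/-monoˡ-≤ b (ℕP.∸-monoˡ-≤ 1 u≤X))) (ℕP.≤-reflexive (ℕP.+-comm 1 ((X ∸ 1) / b)))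

    -- Equal codes give the same block of u and the same Y (as Y ≡ b·X mod p), hence
    -- a·u₁ + b·w₂ = a·u₂ + b·w₁ with |u₁ - u₂| < b, which only has trivial solutions.
    code-injective : ∀ {x y} → x ∈ solutions p X r s → y ∈ solutions p X r s → code x ≡ code y → x ≡ y
    code-injective {u₁ , w₁} {u₂ , w₂} x∈ y∈ eq = cong₂ _,_ (proj₁ trivial) (proj₂ trivial)
      where
      facts₁ = solution-facts x∈
      facts₂ = solution-facts y∈
      1≤u₁ = proj₁ (proj₁ facts₁)
      1≤u₂ = proj₁ (proj₁ facts₂)
      w₁≤X = proj₁ (proj₂ facts₁)
      w₂≤X = proj₁ (proj₂ facts₂)
      digits = digits-unique ((u₁ ∸ 1) / b) ((u₂ ∸ 1) / b) (Y u₁ w₁ / p) (Y u₂ w₂ / p)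
                 (Y-digit< u₁ w₁ (proj₂ (proj₁ facts₁))) (Y-digit< u₂ w₂ (proj₂ (proj₁ facts₂))) eq

      Y-equal : Y u₁ w₁ ≡ Y u₂ w₂
      Y-equal = begin
        Y u₁ w₁                          ≡⟨ m≡m%n+[m/n]*n (Y u₁ w₁) p ⟩
        Y u₁ w₁ % p + (Y u₁ w₁ / p) * p  ≡⟨ cong₂ (λ m q → m + q * p) residues (proj₂ digits) ⟩
        Y u₂ w₂ % p + (Y u₂ w₂ / p) * p  ≡⟨ sym (m≡m%n+[m/n]*n (Y u₂ w₂) p) ⟩
        Y u₂ w₂                          ∎
        where
        open ≡-Reasoning
        residues = trans (Y≡bX u₁ w₁ w₁≤X (proj₂ (proj₂ facts₁))) (sym (Y≡bX u₂ w₂ w₂≤X (proj₂ (proj₂ facts₂))))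

      linear : a * u₁ + b * w₂ ≡ a * u₂ + b * w₁
      linear = ℕP.+-cancelʳ-≡ (b * X) (a * u₁ + b * w₂) (a * u₂ + b * w₁) (begin
        a * u₁ + b * w₂ + b * X   ≡⟨ exchange (a * u₁) (b * w₂) (b * X) ⟩
        a * u₁ + b * X + b * w₂   ≡⟨ cong (_+ b * w₂) (sym (Y+bw u₁ w₁ w₁≤X)) ⟩
        Y u₁ w₁ + b * w₁ + b * w₂ ≡⟨ cong (λ z → z + b * w₁ + b * w₂) Y-equal ⟩
        Y u₂ w₂ + b * w₁ + b * w₂ ≡⟨ exchange (Y u₂ w₂) (b * w₁) (b * w₂) ⟩
        Y u₂ w₂ + b * w₂ + b * w₁ ≡⟨ cong (_+ b * w₁) (Y+bw u₂ w₂ w₂≤X) ⟩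
        a * u₂ + b * X + b * w₁   ≡⟨ exchange (a * u₂) (b * X) (b * w₁) ⟩
        a * u₂ + b * w₁ + b * X   ∎)
        where
        open ≡-Reasoning
        exchange : ∀ x y z → x + y + z ≡ x + z + y
        exchange = solve 3 (λ x y z → x :+ y :+ z := x :+ z :+ y) refl

      close : ∀ {u v} → 1 ≤ u → u ≤ v → (u ∸ 1) / b ≡ (v ∸ 1) / b → v ∸ u < b
      close {suc u} {v} _ u≤v blk = subst (_< b) (ℕP.∸-+-assoc v 1 u) (same-quotient⇒close b (ℕP.∸-monoˡ-≤ 1 u≤v) blk)

      trivial : u₁ ≡ u₂ × w₁ ≡ w₂
      trivial with ℕP.≤-total u₁ u₂
      ... | inj₁ u₁≤u₂ = close-solutions-trivial a b b⊥a u₁≤u₂ (close 1≤u₁ u₁≤u₂ (proj₁ digits)) linear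
      ... | inj₂ u₂≤u₁ = Σ.map sym sym
              (close-solutions-trivial a b b⊥a u₂≤u₁ (close 1≤u₂ u₂≤u₁ (sym (proj₁ digits))) (sym linear))

    #solutions≤ : length (solutions p X r s) ≤ #blocks * #Y-digits
    #solutions≤ = injection-bound code (#blocks * #Y-digits) (solutions p X r s) unique (All.tabulate code<) code-injective
      where
      unique : Unique (solutions p X r s)
      unique = UniqueP.filter⁺ _ (UniqueP.cartesianProduct⁺ support-unique support-unique)
        where support-unique = UniqueP.map⁺ ℕP.suc-injective (UniqueP.upTo⁺ X)

    b·#blocks≤ : b * #blocks ≤ X + b
    b·#blocks≤ = begin
      b * ((X ∸ 1) / b + 1)          ≡⟨ ℕP.*-distribˡ-+ b ((X ∸ 1) / b) 1 ⟩
      b * ((X ∸ 1) / b) + b * 1      ≡⟨ cong₂ _+_ (ℕP.*-comm b _) (ℕP.*-identityʳ b) ⟩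
      ((X ∸ 1) / b) * b + b          ≤⟨ ℕP.+-monoˡ-≤ b (ℕP.≤-trans (m/n*n≤m (X ∸ 1) b) (ℕP.m∸n≤m X 1)) ⟩
      X + b                          ∎
      where open ℕP.≤-Reasoning

    p·#Y-digits≤ : p * #Y-digits ≤ 2 * b * X + p
    p·#Y-digits≤ = begin
      p * ((a + b) * X / p + 1)      ≡⟨ ℕP.*-distribˡ-+ p ((a + b) * X / p) 1 ⟩
      p * ((a + b) * X / p) + p * 1  ≡⟨ cong₂ _+_ (ℕP.*-comm p _) (ℕP.*-identityʳ p) ⟩
      ((a + b) * X / p) * p + p      ≤⟨ ℕP.+-monoˡ-≤ p (m/n*n≤m ((a + b) * X) p) ⟩
      (a + b) * X + p                ≤⟨ ℕP.+-monoˡ-≤ p (ℕP.*-monoˡ-≤ X (ℕP.≤-trans (ℕP.+-monoˡ-≤ b (ℕP.<⇒≤ a<b))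
                                          (ℕP.≤-reflexive (solve 1 (λ b → b :+ b := con 2 :* b) refl b)))) ⟩
      2 * b * X + p                  ∎
      where open ℕP.≤-Reasoning

    collision-bound : p * b * length (solutions p X r s) ≤ (2 * b * X + p) * (X + b)
    collision-bound = begin
      p * b * length (solutions p X r s)  ≤⟨ ℕP.*-monoʳ-≤ (p * b) #solutions≤ ⟩
      p * b * (#blocks * #Y-digits)      ≡⟨ solve 4 (λ p b x y → p :* b :* (x :* y) := (p :* y) :* (b :* x)) refl p b #blocks #Y-digits ⟩
      (p * #Y-digits) * (b * #blocks)    ≤⟨ ℕP.*-mono-≤ p·#Y-digits≤ b·#blocks≤ ⟩
      (2 * b * X + p) * (X + b)          ∎
      where open ℕP.≤-Reasoning

module FewCollisions where

  open import Data.Nat as ℕ using (ℕ; suc; NonZero)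
  import Data.Nat.Properties as ℕP
  open import Data.Nat.Primality using (Prime)
  open import Data.Rational as ℚ using (ℚ; 0ℚ; _≤_; _<_; _+_; _*_)
  import Data.Rational.Properties as ℚP
  open import Relation.Binary.PropositionalEquality
  open import Data.Rational.Solver using (module +-*-Solver)
  open +-*-Solver
  open Cast
  open RationalOrder
  open CountVectors using (collisions; solutions; collisions≡solutions)

  collisions·K≤3X : ∀ (K : ℚ) (p b X C : ℕ) → 0ℚ ≤ K → 1 ℕ.≤ p → 1 ℕ.≤ b →
    p ℕ.* b ℕ.* C ℕ.≤ (2 ℕ.* b ℕ.* X ℕ.+ p) ℕ.* (X ℕ.+ b) →
    toℚ 8 * (toℚ X * K) ≤ toℚ 9 * toℚ p →
    toℚ 4 * K ≤ toℚ b →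
    toℚ 8 * (toℚ b * K) ≤ toℚ p →
    toℚ 4 * K ≤ toℚ X →
    toℚ C * K ≤ toℚ 3 * toℚ X
  collisions·K≤3X K p b X C 0≤K 1≤p 1≤b pbC≤ 8XK≤9p 4K≤b 8bK≤p 4K≤X =
    ℚP.*-cancelˡ-≤-pos Q {{ℚ.positive 0<Q}} (begin
      Q * (Cq * K)
        ≡⟨ solve 4 (λ P B C K → con (toℚ 4) :* (P :* B) :* (C :* K) := con (toℚ 4) :* (P :* B :* C) :* K) refl Pq Bq Cq K ⟩
      toℚ 4 * (Pq * Bq * Cq) * K
        ≤⟨ mulʳ-≤ K 0≤K (mulˡ-≤ (toℚ 4) (toℚ-nonNeg 4) pbC≤′) ⟩
      toℚ 4 * ((toℚ 2 * Bq * Xq + Pq) * (Xq + Bq)) * K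
        ≡⟨ solve 4 (λ P B X K →
             con (toℚ 4) :* ((con (toℚ 2) :* B :* X :+ P) :* (X :+ B)) :* K :=
             (B :* X) :* (con (toℚ 8) :* (X :* K)) :+ (B :* X) :* (con (toℚ 8) :* (B :* K))
             :+ (P :* X) :* (con (toℚ 4) :* K) :+ (P :* B) :* (con (toℚ 4) :* K)) refl Pq Bq Xq K ⟩
      (Bq * Xq) * (toℚ 8 * (Xq * K)) + (Bq * Xq) * (toℚ 8 * (Bq * K)) + (Pq * Xq) * (toℚ 4 * K) + (Pq * Bq) * (toℚ 4 * K)
        ≤⟨ ℚP.+-mono-≤ (ℚP.+-mono-≤ (ℚP.+-mono-≤ (mulˡ-≤ _ 0≤BX 8XK≤9p) (mulˡ-≤ _ 0≤BX 8bK≤p))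
             (mulˡ-≤ _ (nonNeg-* (toℚ-nonNeg p) (toℚ-nonNeg X)) 4K≤b)) (mulˡ-≤ _ (nonNeg-* (toℚ-nonNeg p) (toℚ-nonNeg b)) 4K≤X) ⟩
      (Bq * Xq) * (toℚ 9 * Pq) + (Bq * Xq) * Pq + (Pq * Xq) * Bq + (Pq * Bq) * Xq
        ≡⟨ solve 3 (λ P B X →
             (B :* X) :* (con (toℚ 9) :* P) :+ (B :* X) :* P :+ (P :* X) :* B :+ (P :* B) :* X :=
             con (toℚ 4) :* (P :* B) :* (con (toℚ 3) :* X)) refl Pq Bq Xq ⟩
      Q * (toℚ 3 * Xq) ∎)
    where
    open ℚP.≤-Reasoning
    Pq = toℚ p
    Bq = toℚ b
    Xq = toℚ X
    Cq = toℚ C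
    Q = toℚ 4 * (Pq * Bq)
    0≤BX = nonNeg-* (toℚ-nonNeg b) (toℚ-nonNeg X)
    0<Q : 0ℚ < Q
    0<Q = subst (0ℚ <_) (trans (toℚ-* 4 (p ℕ.* b)) (cong (toℚ 4 *_) (toℚ-* p b)))
            (toℚ-mono-< {0} {4 ℕ.* (p ℕ.* b)} (ℕP.*-mono-≤ (ℕ.s≤s (ℕ.z≤n {3})) (ℕP.*-mono-≤ 1≤p 1≤b)))
    pbC≤′ : Pq * Bq * Cq ≤ (toℚ 2 * Bq * Xq + Pq) * (Xq + Bq)
    pbC≤′ = subst₂ _≤_
      (trans (toℚ-* (p ℕ.* b) C) (cong (_* Cq) (toℚ-* p b)))
      (trans (toℚ-* (2 ℕ.* b ℕ.* X ℕ.+ p) (X ℕ.+ b))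
        (cong₂ _*_ (trans (toℚ-+ (2 ℕ.* b ℕ.* X) p) (cong (_+ Pq) (trans (toℚ-* (2 ℕ.* b) X) (cong (_* Xq) (toℚ-* 2 b)))))
                   (toℚ-+ X b)))
      (toℚ-mono-≤ pbC≤)

  -- For multipliers M < r < s ≤ M + t with M = 4κt and K ≤ κ we have g ≤ t, hence
  -- b = s/g ≥ M/t = 4κ, and b ≤ s gives 8bκ ≤ p.
  block-collisions : ∀ (K : ℚ) κ → 0ℚ ≤ K → K ≤ toℚ κ → ∀ p .{{_ : NonZero p}} → Prime p → 1 ℕ.≤ p →
    ∀ X t r s → 4 ℕ.* κ ℕ.* t ℕ.< r → r ℕ.< s → s ℕ.≤ 4 ℕ.* κ ℕ.* t ℕ.+ t →
    8 ℕ.* (4 ℕ.* κ ℕ.* t ℕ.+ t) ℕ.* κ ℕ.≤ p → s ℕ.< p →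
    toℚ 8 * (toℚ X * K) ≤ toℚ 9 * toℚ p → toℚ 4 * K ≤ toℚ X →
    toℚ (collisions p X r s) * K ≤ toℚ 3 * toℚ X
  block-collisions K κ 0≤K K≤κ p p-prime 1≤p X t r@(suc _) s M<r r<s s≤M+t 8[M+t]κ≤p s<p 8XK≤9p 4K≤X =
    collisions·K≤3X K p b X (collisions p X r s) 0≤K 1≤p 1≤b pbC≤ 8XK≤9p 4K≤b 8bK≤p 4K≤X
    where
    open Collisions.Counting p p-prime X r s r<s s<p
    M = 4 ℕ.* κ ℕ.* t
    pbC≤ : p ℕ.* b ℕ.* collisions p X r s ℕ.≤ (2 ℕ.* b ℕ.* X ℕ.+ p) ℕ.* (X ℕ.+ b)
    pbC≤ = subst (λ z → p ℕ.* b ℕ.* z ℕ.≤ (2 ℕ.* b ℕ.* X ℕ.+ p) ℕ.* (X ℕ.+ b)) (sym (collisions≡solutions p X r s)) collision-bound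
    g≤t : g ℕ.≤ t
    g≤t = ℕP.≤-trans g≤s∸r (ℕP.≤-trans (ℕP.∸-mono s≤M+t (ℕP.<⇒≤ M<r)) (ℕP.≤-reflexive (ℕP.m+n∸m≡n M t)))
    4κ≤b : 4 ℕ.* κ ℕ.≤ b
    4κ≤b = ℕP.*-cancelʳ-≤ (4 ℕ.* κ) b g (ℕP.≤-trans (ℕP.*-monoʳ-≤ (4 ℕ.* κ) g≤t)
             (ℕP.≤-trans (ℕP.<⇒≤ (ℕP.<-trans M<r r<s)) (ℕP.≤-reflexive s≡bg)))
    1≤b : 1 ℕ.≤ b
    1≤b = ℕP.n≢0⇒n>0 (ℕ.≢-nonZero⁻¹ b)
    8bκ≤p : 8 ℕ.* b ℕ.* κ ℕ.≤ p
    8bκ≤p = ℕP.≤-trans (ℕP.*-monoˡ-≤ κ (ℕP.*-monoʳ-≤ 8 (ℕP.≤-trans (subst (b ℕ.≤_) (sym s≡bg) (ℕP.m≤m*n b g)) s≤M+t))) 8[M+t]κ≤p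
    4K≤b : toℚ 4 * K ≤ toℚ b
    4K≤b = ℚP.≤-trans (mulˡ-≤ (toℚ 4) (toℚ-nonNeg 4) K≤κ) (subst (_≤ toℚ b) (toℚ-* 4 κ) (toℚ-mono-≤ 4κ≤b))
    8bK≤p : toℚ 8 * (toℚ b * K) ≤ toℚ p
    8bK≤p = ℚP.≤-trans (mulˡ-≤ (toℚ 8) (toℚ-nonNeg 8) (mulˡ-≤ (toℚ b) (toℚ-nonNeg b) K≤κ))
      (subst (_≤ toℚ p) (trans (toℚ-* (8 ℕ.* b) κ) (trans (cong (_* toℚ κ) (toℚ-* 8 b)) (ℚP.*-assoc (toℚ 8) (toℚ b) (toℚ κ))))
        (toℚ-mono-≤ 8bκ≤p))

module CubeRoot where

  open import Data.Nat as ℕ using (ℕ; zero; suc; _+_; _*_; _∸_; _^_; _≤_; _<_; _≤?_; z≤n; s≤s)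
  import Data.Nat.Properties as ℕP
  open import Relation.Binary.PropositionalEquality
  open import Relation.Nullary using (yes; no)
  open import Relation.Nullary.Negation using (contradiction)
  open import Data.Product using (_×_; _,_)
  open import Data.Nat.Solver using (module +-*-Solver)
  open +-*-Solver

  ⌈∛_⌉ : ℕ → ℕ
  ⌈∛ zero ⌉ = zero
  ⌈∛ suc n ⌉ with suc n ≤? ⌈∛ n ⌉ ^ 3
  ... | yes _ = ⌈∛ n ⌉
  ... | no _ = suc ⌈∛ n ⌉

  cube-suc : ∀ c → suc (c ^ 3) ≤ suc c ^ 3
  cube-suc c = ℕP.≤-trans (ℕP.m≤m+n (suc (c ^ 3)) (3 * (c * c) + 3 * c)) (ℕP.≤-reflexive (expand c))
    where
    expand : ∀ c → suc (c ^ 3) + (3 * (c * c) + 3 * c) ≡ suc c ^ 3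
    expand = solve 1 (λ c → con 1 :+ c :* (c :* (c :* con 1)) :+ (con 3 :* (c :* c) :+ con 3 :* c)
                              := (con 1 :+ c) :* ((con 1 :+ c) :* ((con 1 :+ c) :* con 1))) refl

  ⌈∛⌉-spec : ∀ n → n ≤ ⌈∛ n ⌉ ^ 3 × (1 ≤ n → (⌈∛ n ⌉ ∸ 1) ^ 3 < n)
  ⌈∛⌉-spec zero = z≤n , λ ()
  ⌈∛⌉-spec (suc n) with suc n ≤? ⌈∛ n ⌉ ^ 3 | ⌈∛⌉-spec n
  ... | yes n<t³ | _ , below = n<t³ , λ _ → still-below n n<t³ below
    where
    still-below : ∀ n → suc n ≤ ⌈∛ n ⌉ ^ 3 → (1 ≤ n → (⌈∛ n ⌉ ∸ 1) ^ 3 < n) → (⌈∛ n ⌉ ∸ 1) ^ 3 < suc n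
    still-below zero () _
    still-below (suc n) _ below = ℕP.m<n⇒m<1+n (below (s≤s z≤n))
  ... | no n≮t³ | n≤t³ , _ = ℕP.≤-trans (s≤s n≤t³) (cube-suc ⌈∛ n ⌉) , λ _ → s≤s (ℕP.≮⇒≥ n≮t³)

  -- If (2C+1)³ ≤ n then t = ⌈n^{1/3}⌉ ≥ 2C+1, so C·t ≤ (t-1)³ < n.
  linear<cube : ∀ C n t → 1 ≤ C → (2 * C + 1) ^ 3 ≤ n → n ≤ t ^ 3 → (t ∸ 1) ^ 3 < n → C * t < n
  linear<cube C n t 1≤C [2C+1]³≤n n≤t³ [t-1]³<n with 2 * C + 1 ≤? t
  ... | no t<2C+1 = contradiction (ℕP.<-≤-trans (ℕP.^-monoˡ-< 3 (ℕP.≰⇒> t<2C+1)) (ℕP.≤-trans [2C+1]³≤n n≤t³)) (ℕP.<-irrefl refl)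
  ... | yes 2C+1≤t = ℕP.≤-<-trans Ct≤m³ [t-1]³<n
    where
    m = t ∸ 1
    t≡ : t ≡ suc m
    t≡ = sym (ℕP.m+[n∸m]≡n {1} {t} (ℕP.≤-trans (ℕP.m≤n+m 1 (2 * C)) 2C+1≤t))
    2C≤m : 2 * C ≤ m
    2C≤m = ℕP.≤-trans (ℕP.≤-reflexive (sym (ℕP.m+n∸n≡m (2 * C) 1))) (ℕP.∸-monoˡ-≤ 1 2C+1≤t)
    1≤m : 1 ≤ m
    1≤m = ℕP.≤-trans 1≤C (ℕP.≤-trans (ℕP.m≤m+n C _) 2C≤m)
    Ct≤m³ : C * t ≤ m ^ 3
    Ct≤m³ = begin
      C * t          ≡⟨ cong (C *_) t≡ ⟩
      C * suc m      ≡⟨ ℕP.*-suc C m ⟩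
      C + C * m      ≤⟨ ℕP.+-monoˡ-≤ (C * m) (ℕP.m≤m*n C m {{ℕ.>-nonZero 1≤m}}) ⟩
      C * m + C * m  ≡⟨ solve 2 (λ c m → c :* m :+ c :* m := (con 2 :* c) :* m) refl C m ⟩
      (2 * C) * m    ≤⟨ ℕP.*-monoˡ-≤ m 2C≤m ⟩
      m * m          ≤⟨ ℕP.m≤m*n (m * m) m {{ℕ.>-nonZero 1≤m}} ⟩
      m * m * m      ≡⟨ solve 1 (λ m → m :* m :* m := m :* (m :* (m :* con 1))) refl m ⟩
      m ^ 3          ∎
      where open ℕP.≤-Reasoning

-- The block of t = ⌈p^{1/3}⌉ multipliers (M, M+t] with M = 4κt.  Once
-- (2C+1)³ ≤ p for C = 8κ(4κ+1), it lies below p and 8(M+t)κ = C·t < p.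
module Multipliers (κ : ℕ) where

  open import Data.Nat as ℕ using (suc; z≤n; s≤s; _+_; _*_; _≤_; _<_; _^_)
  import Data.Nat.Properties as ℕP
  open import Data.List using (List; map; upTo; length)
  import Data.List.Properties as LP
  open import Data.List.Relation.Unary.Unique.Propositional using (Unique)
  import Data.List.Relation.Unary.Unique.Propositional.Properties as UniqueP
  open import Data.List.Membership.Propositional using (_∈_)
  import Data.List.Membership.Propositional.Properties as ∈P
  open import Relation.Binary.PropositionalEquality
  open import Data.Product using (_×_; _,_; proj₁; proj₂)
  open import Data.Nat.Solver using (module +-*-Solver)
  open +-*-Solver
  open CubeRoot

  C : ℕ
  C = 8 * κ * (4 * κ + 1)

  module _ (p : ℕ) where

    t = ⌈∛ p ⌉
    M = 4 * κ * t

    multipliers : List ℕ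
    multipliers = map (λ i → M + suc i) (upTo t)

    multiplier-range : ∀ {q} → q ∈ multipliers → M < q × q ≤ M + t
    multiplier-range q∈ with ∈P.∈-map⁻ (λ i → M + suc i) q∈
    ... | i , i∈ , refl = subst (_≤ M + suc i) (ℕP.+-comm M 1) (ℕP.+-monoʳ-≤ M (s≤s z≤n)) , ℕP.+-monoʳ-≤ M (∈P.∈-upTo⁻ i∈)

    multipliers-unique : Unique multipliers
    multipliers-unique = UniqueP.map⁺ (λ eq → ℕP.suc-injective (ℕP.+-cancelˡ-≡ M _ _ eq)) (UniqueP.upTo⁺ t)

    multipliers-many : p ≤ length multipliers ^ 3
    multipliers-many = subst (λ n → p ≤ n ^ 3) (sym (trans (LP.length-map _ (upTo t)) (LP.length-upTo t))) (proj₁ (⌈∛⌉-spec p))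

    module _ (1≤κ : 1 ≤ κ) ([2C+1]³≤p : (2 * C + 1) ^ 3 ≤ p) (1≤p : 1 ≤ p) where

      Ct<p : C * t < p
      Ct<p = linear<cube C p t (ℕP.*-mono-≤ (ℕP.*-mono-≤ (s≤s (z≤n {7})) 1≤κ) (ℕP.m≤n+m 1 (4 * κ)))
               [2C+1]³≤p (proj₁ (⌈∛⌉-spec p)) (proj₂ (⌈∛⌉-spec p) 1≤p)

      8[M+t]κ<p : 8 * (M + t) * κ < p
      8[M+t]κ<p = subst (_< p) (solve 2 (λ κ t → con 8 :* κ :* (con 4 :* κ :+ con 1) :* t := con 8 :* (con 4 :* κ :* t :+ t) :* κ) refl κ t) Ct<p

      M+t<p : M + t < p
      M+t<p = ℕP.≤-<-trans (ℕP.≤-trans (ℕP.m≤m*n (M + t) (8 * κ) {{ℕ.>-nonZero (ℕP.≤-trans (s≤s z≤n) (ℕP.*-monoʳ-≤ 8 1≤κ))}}) (ℕP.≤-reflexive (reassoc (M + t) κ))) 8[M+t]κ<p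
        where
        reassoc : ∀ x y → x * (8 * y) ≡ 8 * x * y
        reassoc = solve 2 (λ x y → x :* (con 8 :* y) := con 8 :* x :* y) refl

module Constants (c K : ℚ) (c>0 : 0ℚ <ℚ c) (K>0 : 0ℚ <ℚ K) where

  open import Data.Nat as ℕ using (suc)
  import Data.Nat.Properties as ℕP
  open import Data.Integer as ℤ using ()
  open import Data.Rational as ℚ using (1ℚ; _≤_; _+_; _*_)
  import Data.Rational.Properties as ℚP
  open import Relation.Binary.PropositionalEquality
  open import Data.Product using (_×_; _,_; proj₁; proj₂)
  open import Data.Rational.Solver using (module +-*-Solver)
  open +-*-Solver
  open Cast
  open Ceiling
  open RationalOrder
  open SizeOfX

  0≤K = ℚP.<⇒≤ K>0

  κ : ℕ
  κ = suc ℤ.∣ ℚ.ceiling K ∣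

  K≤κ : K ≤ toℚ κ
  K≤κ = ℚP.≤-trans (proj₁ (ceiling-bounds K 0≤K)) (toℚ-mono-≤ (ℕP.n≤1+n ℤ.∣ ℚ.ceiling K ∣))

  1≤κ : 1 ℕ.≤ κ
  1≤κ = ℕ.s≤s ℕ.z≤n

  γ : ℕ
  γ = ℤ.∣ ℚ.ceiling ((c + 1ℚ) * K) ∣

  [c+1]K≤γ : (c + 1ℚ) * K ≤ toℚ γ
  [c+1]K≤γ = proj₁ (ceiling-bounds _ (nonNeg-* (ℚP.+-mono-≤ (ℚP.<⇒≤ c>0) (toℚ-nonNeg 1)) 0≤K))

  [2C+1]³ : ℕ
  [2C+1]³ = (2 ℕ.* Multipliers.C κ ℕ.+ 1) ℕ.^ 3

  A₀ : ℕ
  A₀ = [2C+1]³ ℕ.+ 8 ℕ.* γ ℕ.+ 4 ℕ.* (κ ℕ.* κ)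

  module _ (p : ℕ) (A₀≤p : A₀ ℕ.≤ p) where

    [2C+1]³≤p : [2C+1]³ ℕ.≤ p
    [2C+1]³≤p = ℕP.≤-trans (ℕP.≤-trans (ℕP.m≤m+n [2C+1]³ (8 ℕ.* γ)) (ℕP.m≤m+n ([2C+1]³ ℕ.+ 8 ℕ.* γ) (4 ℕ.* (κ ℕ.* κ)))) A₀≤p

    8γ≤p : 8 ℕ.* γ ℕ.≤ p
    8γ≤p = ℕP.≤-trans (ℕP.≤-trans (ℕP.m≤n+m (8 ℕ.* γ) [2C+1]³) (ℕP.m≤m+n ([2C+1]³ ℕ.+ 8 ℕ.* γ) (4 ℕ.* (κ ℕ.* κ)))) A₀≤p

    4κ²≤p : 4 ℕ.* (κ ℕ.* κ) ℕ.≤ p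
    4κ²≤p = ℕP.≤-trans (ℕP.m≤n+m (4 ℕ.* (κ ℕ.* κ)) ([2C+1]³ ℕ.+ 8 ℕ.* γ)) A₀≤p

    1≤p : 1 ℕ.≤ p
    1≤p = ℕP.≤-trans (ℕ.s≤s ℕ.z≤n) 4κ²≤p

    X-range : ∀ X → IsCeilCSqrt c (N′ c K c>0 K>0 p) X →
      (toℚ 8 * (toℚ X * K) ≤ toℚ 9 * toℚ p) × (toℚ 4 * K ≤ toℚ X)
    X-range X isCeil = 8XK≤9p , 4K≤X
      where
      open ℚP.≤-Reasoning
      bounds = X-bounds c K c>0 K>0 p X isCeil
      8XK≤9p = begin
        toℚ 8 * (toℚ X * K)
          ≤⟨ mulˡ-≤ (toℚ 8) (toℚ-nonNeg 8) (ℚP.≤-trans (ℚP.<⇒≤ (proj₂ bounds)) (ℚP.+-monoʳ-≤ (toℚ p) [c+1]K≤γ)) ⟩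
        toℚ 8 * (toℚ p + toℚ γ)
          ≡⟨ trans (ℚP.*-distribˡ-+ (toℚ 8) (toℚ p) (toℚ γ)) (cong (λ z → toℚ 8 * toℚ p + z) (sym (toℚ-* 8 γ))) ⟩
        toℚ 8 * toℚ p + toℚ (8 ℕ.* γ)
          ≤⟨ ℚP.+-monoʳ-≤ (toℚ 8 * toℚ p) (toℚ-mono-≤ 8γ≤p) ⟩
        toℚ 8 * toℚ p + toℚ p
          ≡⟨ solve 1 (λ P → con (toℚ 8) :* P :+ P := con (toℚ 9) :* P) refl (toℚ p) ⟩
        toℚ 9 * toℚ p ∎
      4K≤X = ℚP.*-cancelʳ-≤-pos K {{ℚ.positive K>0}} (begin
        toℚ 4 * K * K
          ≤⟨ mul-≤ (nonNeg-* (toℚ-nonNeg 4) 0≤K) (toℚ-nonNeg κ) (mulˡ-≤ (toℚ 4) (toℚ-nonNeg 4) K≤κ) K≤κ ⟩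
        toℚ 4 * toℚ κ * toℚ κ
          ≡⟨ trans (ℚP.*-assoc (toℚ 4) (toℚ κ) (toℚ κ)) (trans (cong (toℚ 4 *_) (sym (toℚ-* κ κ))) (sym (toℚ-* 4 (κ ℕ.* κ)))) ⟩
        toℚ (4 ℕ.* (κ ℕ.* κ))
          ≤⟨ toℚ-mono-≤ 4κ²≤p ⟩
        toℚ p
          ≤⟨ proj₁ bounds ⟩
        toℚ X * K ∎)

open import Data.Nat using (ℕ; NonZero; _≤_; _^_)
open import Relation.Binary.PropositionalEquality using (_≢_)
open import Data.Nat.Primality using (Prime)
open import Data.Rational using (ℚ; 0ℚ; _<_) renaming (_≤_ to _≤ℚ_)
open import Data.Product using (Σ; ∃; _×_; _,_; proj₁; proj₂)
open import Data.List using (List; length)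
open import Data.List.Relation.Unary.All using (All)
open import Data.List.Relation.Unary.Unique.Propositional using (Unique)
open import Data.List.Membership.Propositional using (_∈_)
import Data.Nat as ℕ
import Data.Nat.Properties as ℕP
import Data.List.Relation.Unary.All as All
open import Data.Empty using (⊥-elim)

-- X = 0 is excluded by the
-- hypothesis on X; for X ≥ 1 the block of multipliers has the required size and
-- position, and every pair in it has few collisions (steps (2),(3)), hence is far
-- apart in total variation (step (1)).
theorem74 : (c K : ℚ) (c>0 : 0ℚ < c) (K>0 : 0ℚ < K) →
    ∃ λ A₀ → (a₃ : ℕ) .{{_ : NonZero a₃}} → Prime a₃ → A₀ ≤ a₃ →
    (X : ℕ) → IsCeilCSqrt c (N′ c K c>0 K>0 a₃) X →
    Σ (List ℕ) λ qs →
      Unique qs ×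
      All (λ q → 1 ≤ q × q ≤ a₃) qs ×
      a₃ ≤ length qs ^ 3 ×
      (∀ {q q′} → q ∈ qs → q′ ∈ qs → q ≢ q′ →
        bound K K>0 ≤ℚ dTV a₃ X q q′)
theorem74 c K c>0 K>0 = A₀ , λ p p-prime A₀≤p X isCeil →
    multipliers p , multipliers-unique p , All.tabulate (in-range p A₀≤p) , multipliers-many p ,
    far-apart-pairs p p-prime A₀≤p X isCeil
  where
  open Constants c K c>0 K>0
  open Multipliers κ

  in-range : ∀ p → A₀ ≤ p → ∀ {q} → q ∈ multipliers p → 1 ≤ q × q ≤ p
  in-range p A₀≤p q∈ = ℕP.≤-trans (ℕ.s≤s ℕ.z≤n) (proj₁ (multiplier-range p q∈)) ,
    ℕP.≤-trans (proj₂ (multiplier-range p q∈)) (ℕP.<⇒≤ (M+t<p p 1≤κ ([2C+1]³≤p p A₀≤p) (1≤p p A₀≤p)))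

  far-apart-pairs : ∀ p .{{_ : NonZero p}} → Prime p → A₀ ≤ p → ∀ X → IsCeilCSqrt c (N′ c K c>0 K>0 p) X →
    ∀ {q q′} → q ∈ multipliers p → q′ ∈ multipliers p → q ≢ q′ → bound K K>0 ≤ℚ dTV p X q q′
  far-apart-pairs p p-prime A₀≤p ℕ.zero (c²N≤0 , 0<c²N) = ⊥-elim (RationalOrder.<⇒≱ 0<c²N c²N≤0)
  far-apart-pairs p p-prime A₀≤p X@(ℕ.suc k) isCeil = TotalVariation.far-apart K K>0 p k (multipliers p)
    λ {r} {s} r<s r∈ s∈ → FewCollisions.block-collisions K κ 0≤K K≤κ p p-prime (1≤p p A₀≤p) X (t p) r s
      (proj₁ (multiplier-range p r∈)) r<s (proj₂ (multiplier-range p s∈))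
      (ℕP.<⇒≤ (8[M+t]κ<p p 1≤κ [2C+1]³≤p′ (1≤p p A₀≤p)))
      (ℕP.≤-<-trans (proj₂ (multiplier-range p s∈)) (M+t<p p 1≤κ [2C+1]³≤p′ (1≤p p A₀≤p)))
      (proj₁ (X-range p A₀≤p X isCeil)) (proj₂ (X-range p A₀≤p X isCeil))
    where [2C+1]³≤p′ = [2C+1]³≤p p A₀≤p
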